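{- Let $\Gamma$ be a subgroup of finite index in $\mathrm{SL}_3(\mathbb{Z})$ and $E$ a real quadratic field. Let $h\in\mathrm{GL}_2(\mathbb{Z})$ be unital, $u\in\mathbb{Z}^2$, $\epsilon=\det(h)$, and $M(h,u)=\begin{bmatrix}h&u\\0&\epsilon\end{bmatrix}\in\mathrm{SL}_3(\mathbb{Z})$. Suppose $M(h,u)$ has an eigenbasis of $E^3$ of the form $\{b,b',a\}$ with $b\in E^3$, $b'$ its Galois conjugate, and $a\in\mathbb{Z}^3$. Let $d\in\mathrm{SL}_3(\mathbb{Z})$, let $\gamma$ be the smallest positive power of $dM(h,u)d^{ -1}$ lying in $\Gamma$, and let $f=de$ with $e={}^t(1,0,0)$. Then for every integer $m>0$, $[f,\gamma^m f,da]_\Gamma=m\,[f,\gamma f,da]_\Gamma$ in $H_0(\Gamma,\mathrm{St}(\mathbb{Q}^3))$.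
   Context: $\mathrm{St}(\mathbb{Q}^3)$ is the Steinberg module with $\mathbb{Q}$-coefficients, $\tilde H_1$ of the Tits building of $\mathbb{Q}^3$ (vertices: proper nonzero subspaces, simplices: flags). For a basis $v_1,v_2,v_3$ of $\mathbb{Q}^3$, $[v_1,v_2,v_3]$ is the fundamental class of the hexagon whose vertices are the spans of proper nonempty subsets of $\{v_1,v_2,v_3\}$, oriented so that $g[v_1,v_2,v_3]=[gv_1,gv_2,gv_3]$; $[w_1,w_2,w_3]=0$ if the $w_i$ are dependent. $[m]_\Gamma$ denotes the image in the coinvariants $H_0(\Gamma,\mathrm{St}(\mathbb{Q}^3))$. A matrix $h\in\mathrm{GL}_2(\mathbb{Z})$ is unital if $h\,{}^t(\beta,1)\in E^\times\,{}^t(\beta,1)$ for some $\beta\in E\setminus\mathbb{Q}$. -}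

module Defs where

open import Data.Nat as ℕ using (ℕ; zero; suc)
open import Data.Nat.Divisibility using (_∣_)
open import Data.Integer as ℤ using (ℤ)
open import Data.Rational as ℚ using (ℚ; 0ℚ; 1ℚ)
open import Data.Rational.Properties using () renaming (_≟_ to _≟ℚ_)
open import Data.Bool using (Bool; true; false; _∧_; if_then_else_)
open import Data.List using (List; []; _∷_; _++_; map; concatMap)
open import Data.List.Relation.Unary.All using (All)
open import Data.List.Membership.Propositional using (_∈_)
open import Data.Sum using (_⊎_)
open import Data.Product using (_×_; _,_; Σ; ∃; proj₁; proj₂)
open import Relation.Binary.PropositionalEquality using (_≡_)
open import Relation.Nullary using (¬_)
open import Relation.Nullary.Decidable using (⌊_⌋)

record V3 (A : Set) : Set where
  constructor v3
  field x y z : A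
open V3 public

record V2 (A : Set) : Set where
  constructor v2
  field p q : A
open V2 public

-- a 3x3 matrix is given by its three rows
M3 : Set → Set
M3 A = V3 (V3 A)

M2 : Set → Set
M2 A = V2 (V2 A)

module RingOps {A : Set} (_+_ _*_ : A → A → A) (-_ : A → A) (0# 1# : A) where

  _-_ : A → A → A
  a - b = a + (- b)

  zero3 : V3 A
  zero3 = v3 0# 0# 0#

  _+v_ : V3 A → V3 A → V3 A
  v3 a b c +v v3 a' b' c' = v3 (a + a') (b + b') (c + c')

  _·v_ : A → V3 A → V3 A
  k ·v v3 a b c = v3 (k * a) (k * b) (k * c)

  dot : V3 A → V3 A → A
  dot (v3 a b c) (v3 a' b' c') = ((a * a') + (b * b')) + (c * c')

  cross : V3 A → V3 A → V3 A
  cross (v3 a b c) (v3 a' b' c') =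
    v3 ((b * c') - (c * b')) ((c * a') - (a * c')) ((a * b') - (b * a'))

  det3v : V3 A → V3 A → V3 A → A
  det3v u v w = dot u (cross v w)

  det3 : M3 A → A
  det3 (v3 r1 r2 r3) = det3v r1 r2 r3

  _*v_ : M3 A → V3 A → V3 A
  v3 r1 r2 r3 *v v = v3 (dot r1 v) (dot r2 v) (dot r3 v)

  col : M3 A → V3 A → V3 A
  col m v = m *v v

  transpose : M3 A → M3 A
  transpose (v3 (v3 a b c) (v3 d e f) (v3 g h i)) =
    v3 (v3 a d g) (v3 b e h) (v3 c f i)

  _*M_ : M3 A → M3 A → M3 A
  v3 r1 r2 r3 *M n = v3 (transpose n *v r1) (transpose n *v r2) (transpose n *v r3)

  idM : M3 A
  idM = v3 (v3 1# 0# 0#) (v3 0# 1# 0#) (v3 0# 0# 1#)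

  -- adjugate: its columns are r2×r3, r3×r1, r1×r2 (r_i the rows of m),
  -- so m *M adj m = det m · I; cof m = (adj m)ᵗ.
  adj : M3 A → M3 A
  adj (v3 r1 r2 r3) = transpose (v3 (cross r2 r3) (cross r3 r1) (cross r1 r2))

  cof : M3 A → M3 A
  cof m = transpose (adj m)

  pow : M3 A → ℕ → M3 A
  pow m zero = idM
  pow m (suc n) = m *M pow m n

module Zops = RingOps ℤ._+_ ℤ._*_ ℤ.-_ (ℤ.+ 0) (ℤ.+ 1)
module Qops = RingOps ℚ._+_ ℚ._*_ ℚ.-_ 0ℚ 1ℚ

ℤtoℚ : ℤ → ℚ
ℤtoℚ n = n ℚ./ 1

vℤtoℚ : V3 ℤ → V3 ℚ
vℤtoℚ (v3 a b c) = v3 (ℤtoℚ a) (ℤtoℚ b) (ℤtoℚ c)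

InSL3 : M3 ℤ → Set
InSL3 g = Zops.det3 g ≡ ℤ.+ 1

det2 : M2 ℤ → ℤ
det2 (v2 (v2 a b) (v2 c d)) = a ℤ.* d ℤ.- b ℤ.* c

InGL2 : M2 ℤ → Set
InGL2 h = (det2 h ≡ ℤ.+ 1) ⊎ (det2 h ≡ ℤ.- (ℤ.+ 1))

-- Γ ⊆ SL₃(ℤ) is a subgroup of finite index.  For g ∈ SL₃(ℤ), g⁻¹ = adj g.
record FiniteIndexSubgroup (Γ : M3 ℤ → Set) : Set where
  field
    sub   : ∀ g → Γ g → InSL3 g
    one   : Γ Zops.idM
    mul   : ∀ g k → Γ g → Γ k → Γ (g Zops.*M k)
    inv   : ∀ g → Γ g → Γ (Zops.adj g)
    -- finitely many left cosets r Γ cover SL₃(ℤ)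
    reps  : List (M3 ℤ)
    repsSL : All InSL3 reps
    cover : ∀ g → InSL3 g →
            Σ (M3 ℤ) λ r → (r ∈ reps) × Γ (Zops.adj r Zops.*M g)

-- M(h,u) = [[h, u],[0, det h]]
Mhu : M2 ℤ → V2 ℤ → M3 ℤ
Mhu h u = v3 (v3 (V2.p (V2.p h)) (V2.q (V2.p h)) (V2.p u))
             (v3 (V2.p (V2.q h)) (V2.q (V2.q h)) (V2.q u))
             (v3 (ℤ.+ 0) (ℤ.+ 0) (det2 h))

-- The real quadratic field E = ℚ(√D), D ≥ 2 squarefree.
-- An element ⟨a , b⟩ stands for a + b√D.

SquarefreeGe2 : ℕ → Set
SquarefreeGe2 D = (2 ℕ.≤ D) × (∀ (k : ℕ) → (k ℕ.* k) ∣ D → k ≡ 1)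

record E : Set where
  constructor ⟨_,_⟩
  field re im : ℚ
open E public

module Eops (D : ℕ) where
  Dℚ : ℚ
  Dℚ = ℤ.+ D ℚ./ 1

  infixl 6 _+E_
  infixl 7 _*E_
  _+E_ : E → E → E
  ⟨ a , b ⟩ +E ⟨ c , d ⟩ = ⟨ a ℚ.+ c , b ℚ.+ d ⟩

  _*E_ : E → E → E
  ⟨ a , b ⟩ *E ⟨ c , d ⟩ = ⟨ a ℚ.* c ℚ.+ Dℚ ℚ.* (b ℚ.* d) , a ℚ.* d ℚ.+ b ℚ.* c ⟩

  -E_ : E → E
  -E ⟨ a , b ⟩ = ⟨ ℚ.- a , ℚ.- b ⟩

  0E 1E : E
  0E = ⟨ 0ℚ , 0ℚ ⟩
  1E = ⟨ 1ℚ , 0ℚ ⟩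

  conj : E → E
  conj ⟨ a , b ⟩ = ⟨ a , ℚ.- b ⟩

  ℤtoE : ℤ → E
  ℤtoE n = ⟨ ℤtoℚ n , 0ℚ ⟩

  module Ev = RingOps _+E_ _*E_ -E_ 0E 1E

  vℤtoE : V3 ℤ → V3 E
  vℤtoE (v3 a b c) = v3 (ℤtoE a) (ℤtoE b) (ℤtoE c)

  mℤtoE : M3 ℤ → M3 E
  mℤtoE (v3 a b c) = v3 (vℤtoE a) (vℤtoE b) (vℤtoE c)

  conjV : V3 E → V3 E
  conjV (v3 a b c) = v3 (conj a) (conj b) (conj c)

  -- h ∈ GL₂(ℤ) is unital: h ᵗ(β,1) ∈ E^× ᵗ(β,1) for some β ∈ E ∖ ℚ
  Unital : M2 ℤ → Set
  Unital h = Σ E λ β → Σ E λ λ' → ¬ (im β ≡ 0ℚ) × ¬ (λ' ≡ 0E) ×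
    (ℤtoE (V2.p (V2.p h)) *E β +E ℤtoE (V2.q (V2.p h)) ≡ λ' *E β) ×
    (ℤtoE (V2.p (V2.q h)) *E β +E ℤtoE (V2.q (V2.q h)) ≡ λ')

  Eigen : M3 ℤ → V3 E → Set
  Eigen g v = Σ E λ μ → mℤtoE g Ev.*v v ≡ μ Ev.·v v

  Basis3 : V3 E → V3 E → V3 E → Set
  Basis3 u v w = ∀ c₁ c₂ c₃ →
    (c₁ Ev.·v u) Ev.+v ((c₂ Ev.·v v) Ev.+v (c₃ Ev.·v w)) ≡ Ev.zero3 →
    (c₁ ≡ 0E) × (c₂ ≡ 0E) × (c₃ ≡ 0E)

-- Vertices: lines ⟨v⟩ (v ≠ 0) and planes n^⊥ (n ≠ 0, n a normal vector);
-- both are determined up to nonzero scaling.  Simplices of dimension 1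
-- (edges) are flags line ⊂ plane, i.e. pairs (v , n) with n·v = 0.

open Qops using (zero3; cross; dot)

isZero3 : V3 ℚ → Bool
isZero3 (v3 a b c) = ⌊ a ≟ℚ 0ℚ ⌋ ∧ ⌊ b ≟ℚ 0ℚ ⌋ ∧ ⌊ c ≟ℚ 0ℚ ⌋

-- same line / same plane (for nonzero vectors): proportionality
parallel : V3 ℚ → V3 ℚ → Bool
parallel u w = isZero3 (cross u w)

Edge : Set
Edge = V3 ℚ × V3 ℚ

WFEdge : Edge → Set
WFEdge (v , n) = ¬ (v ≡ zero3) × ¬ (n ≡ zero3) × (dot n v ≡ 0ℚ)

sameEdge : Edge → Edge → Bool
sameEdge (v , n) (v' , n') = parallel v v' ∧ parallel n n'

-- 1-chains: finite formal ℚ-combinations of oriented edges (line → plane)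
Chain : Set
Chain = List (ℚ × Edge)

WFChain : Chain → Set
WFChain c = All (λ qe → WFEdge (proj₂ qe)) c

coeff : Chain → Edge → ℚ
coeff [] e = 0ℚ
coeff ((q , e') ∷ c) e = if sameEdge e' e then q ℚ.+ coeff c e else coeff c e

_≈C_ : Chain → Chain → Set
c ≈C c' = ∀ e → WFEdge e → coeff c e ≡ coeff c' e

-- boundary ∂(line → plane) = plane - line, evaluated at vertices
lineCoeff∂ : Chain → V3 ℚ → ℚ
lineCoeff∂ [] w = 0ℚ
lineCoeff∂ ((q , (v , n)) ∷ c) w =
  if parallel v w then ℚ.- q ℚ.+ lineCoeff∂ c w else lineCoeff∂ c w

planeCoeff∂ : Chain → V3 ℚ → ℚ
planeCoeff∂ [] w = 0ℚ
planeCoeff∂ ((q , (v , n)) ∷ c) w =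
  if parallel n w then q ℚ.+ planeCoeff∂ c w else planeCoeff∂ c w

-- 1-cycles.  The building is 1-dimensional, so H̃₁ = Z₁ = St(ℚ³).
Cycle : Chain → Set
Cycle c = (∀ w → ¬ (w ≡ zero3) → lineCoeff∂ c w ≡ 0ℚ) ×
          (∀ w → ¬ (w ≡ zero3) → planeCoeff∂ c w ≡ 0ℚ)

InSt : Chain → Set
InSt c = WFChain c × Cycle c

scaleC : ℚ → Chain → Chain
scaleC k = map (λ qe → (k ℚ.* proj₁ qe , proj₂ qe))

negC : Chain → Chain
negC = scaleC (ℚ.- 1ℚ)

-- action of g ∈ SL₃(ℤ): lines by g, planes (normals) by the cofactor
-- matrix cof g = (g⁻¹)ᵗ
actC : M3 ℤ → Chain → Chain
actC g = map (λ { (q , (v , n)) → (q , (gq Qops.*v v , Qops.cof gq Qops.*v n)) })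
  where
  gq : M3 ℚ
  gq = let open V3 in
    v3 (vℤtoℚ (x g)) (vℤtoℚ (y g)) (vℤtoℚ (z g))

-- apartment class [v₁,v₂,v₃]: the hexagon
-- ⟨v₁⟩ – ⟨v₁,v₂⟩ – ⟨v₂⟩ – ⟨v₂,v₃⟩ – ⟨v₃⟩ – ⟨v₃,v₁⟩ – ⟨v₁⟩,
-- and 0 if the vectors are dependent.
hex : V3 ℚ → V3 ℚ → V3 ℚ → Chain
hex v₁ v₂ v₃ =
  if ⌊ Qops.det3v v₁ v₂ v₃ ≟ℚ 0ℚ ⌋ then []
  else ( (1ℚ , (v₁ , cross v₁ v₂)) ∷ (ℚ.- 1ℚ , (v₂ , cross v₁ v₂))
       ∷ (1ℚ , (v₂ , cross v₂ v₃)) ∷ (ℚ.- 1ℚ , (v₃ , cross v₂ v₃))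
       ∷ (1ℚ , (v₃ , cross v₃ v₁)) ∷ (ℚ.- 1ℚ , (v₁ , cross v₃ v₁)) ∷ [])

hexℤ : V3 ℤ → V3 ℤ → V3 ℤ → Chain
hexℤ a b c = hex (vℤtoℚ a) (vℤtoℚ b) (vℤtoℚ c)

-- equality of images in the coinvariants H₀(Γ, St(ℚ³)) = St / ⟨g·z - z⟩:
-- c - c' is a sum of terms g·z - z with g ∈ Γ, z ∈ St.
CoinvEq : (M3 ℤ → Set) → Chain → Chain → Set
CoinvEq Γ c c' = Σ (List (M3 ℤ × Chain)) λ ws →
  All (λ w → Γ (proj₁ w) × InSt (proj₂ w)) ws ×
  ((c ++ negC c') ≈C concatMap (λ w → actC (proj₁ w) (proj₂ w) ++ negC (proj₂ w)) ws)

LeastPowerIn : (M3 ℤ → Set) → M3 ℤ → ℕ → Set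
LeastPowerIn Γ g n = (1 ℕ.≤ n) × Γ (Zops.pow g n) ×
  (∀ k → 1 ℕ.≤ k → k ℕ.< n → ¬ Γ (Zops.pow g k))

e₁ : V3 ℤ
e₁ = v3 (ℤ.+ 1) (ℤ.+ 0) (ℤ.+ 0)

-- The matrix γ = (d M d⁻¹)ⁿ with M = M(h,u) preserves the plane P = d⟨e₁,e₂⟩, which contains
-- f = d e₁, and maps the line through da to itself because a is an eigenvector of M. Since f, γᵏf
-- and γᵏ⁺¹f all lie in P, the cocycle relation for apartment classes gives
--   [f, γᵏ⁺¹f, da] = [f, γᵏf, da] + [γᵏf, γᵏ⁺¹f, γᵏda] = [f, γᵏf, da] + γᵏ[f, γf, da],
-- where γᵏda may replace da because it spans the same line. Summing, [f, γᵐf, da] is the sum of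
-- the translates γᵏ[f, γf, da] for k < m, and each of them has the image of [f, γf, da] in the
-- coinvariants because γᵏ ∈ Γ.
--
-- The coefficient of an apartment class on an edge depends
-- only on six incidences (is the edge's line one of the three lines, its plane one of the three
-- planes), so the relations above reduce to ring identities between these indicators.

module Submission where

open import Defs
open import Level using (0ℓ)
open import Data.Bool using (Bool; true; false; _∧_)
open import Data.Bool.Properties using (⇔→≡)
open import Data.Empty using (⊥-elim)
open import Data.Fin using (#_)
open import Data.Integer as ℤ using (ℤ)
import Data.Integer.Properties as ℤP
import Data.Integer.Tactic.RingSolver as ℤSolver
open import Data.List using (List; []; _∷_; _++_; foldr; concatMap)
open import Data.List.Relation.Unary.All using (All; []; _∷_)
open import Data.Maybe using (Maybe; just; nothing)
open import Data.Nat as ℕ using (ℕ; zero; suc)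
open import Data.Product using (_×_; Σ; _,_; proj₁; proj₂)
open import Data.Rational as ℚ using (ℚ; 0ℚ; 1ℚ)
import Data.Rational.Properties as ℚP
import Data.Rational.Unnormalised as ℚᵘ
import Data.Rational.Unnormalised.Properties as ℚᵘP
open import Data.Vec using (Vec; []; _∷_)
open import Function.Bundles using (mk⇔)
open import Relation.Binary.PropositionalEquality
open import Relation.Nullary using (¬_; Dec; yes; no)
open import Tactic.RingSolver.Core.AlmostCommutativeRing
  using (AlmostCommutativeRing; fromCommutativeRing)
import Tactic.RingSolver.NonReflective as NonReflective

v3-cong : ∀ {A : Set} {a b c a′ b′ c′ : A} → a ≡ a′ → b ≡ b′ → c ≡ c′ → v3 a b c ≡ v3 a′ b′ c′
v3-cong refl refl refl = refl

-- Identities between polynomials in the coordinates of three vectors 𝐚 𝐛 𝐜, a matrix 𝐌 and two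
-- scalars 𝐬 𝐭 are checked by the ring solver. `env` feeds the actual coordinates into these twenty
-- variables; by η for V3 the evaluated symbolic terms are then definitionally the original ones.
module CoordinateSolver (R : AlmostCommutativeRing 0ℓ 0ℓ)
  (≈⇒≡ : ∀ {a b} → AlmostCommutativeRing._≈_ R a b → a ≡ b) where
  open AlmostCommutativeRing R using (Carrier; _≈_; 0#; 1#)
  open NonReflective R using (Expr; Ι; Κ; _⊕_; _⊗_; ⊝_)
  open NonReflective.Ops R using (⟦_⟧; ⟦_⇓⟧; prove)

  Poly : Set
  Poly = Expr Carrier 20

  module Sym = RingOps {Poly} _⊕_ _⊗_ ⊝_ (Κ 0#) (Κ 1#)

  𝐚 𝐛 𝐜 : V3 Poly
  𝐚 = v3 (Ι (# 0)) (Ι (# 1)) (Ι (# 2))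
  𝐛 = v3 (Ι (# 3)) (Ι (# 4)) (Ι (# 5))
  𝐜 = v3 (Ι (# 6)) (Ι (# 7)) (Ι (# 8))

  𝐌 : M3 Poly
  𝐌 = v3 (v3 (Ι (# 9)) (Ι (# 10)) (Ι (# 11)))
         (v3 (Ι (# 12)) (Ι (# 13)) (Ι (# 14)))
         (v3 (Ι (# 15)) (Ι (# 16)) (Ι (# 17)))

  𝐬 𝐭 : Poly
  𝐬 = Ι (# 18)
  𝐭 = Ι (# 19)

  env : V3 Carrier → V3 Carrier → V3 Carrier → M3 Carrier → Carrier → Carrier → Vec Carrier 20
  env a b c m s t =
    x a ∷ y a ∷ z a ∷ x b ∷ y b ∷ z b ∷ x c ∷ y c ∷ z c ∷
    x (x m) ∷ y (x m) ∷ z (x m) ∷ x (y m) ∷ y (y m) ∷ z (y m) ∷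
    x (z m) ∷ y (z m) ∷ z (z m) ∷ s ∷ t ∷ []

  ⟦_⟧v : V3 Poly → Vec Carrier 20 → V3 Carrier
  ⟦ v ⟧v ρ = v3 (⟦ x v ⟧ ρ) (⟦ y v ⟧ ρ) (⟦ z v ⟧ ρ)

  scalar-identity : ∀ ρ (p q : Poly) → ⟦ p ⇓⟧ ρ ≈ ⟦ q ⇓⟧ ρ → ⟦ p ⟧ ρ ≡ ⟦ q ⟧ ρ
  scalar-identity ρ p q eq = ≈⇒≡ (prove ρ p q eq)

  vector-identity : ∀ ρ (u w : V3 Poly) →
    ⟦ x u ⇓⟧ ρ ≈ ⟦ x w ⇓⟧ ρ → ⟦ y u ⇓⟧ ρ ≈ ⟦ y w ⇓⟧ ρ → ⟦ z u ⇓⟧ ρ ≈ ⟦ z w ⇓⟧ ρ →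
    ⟦ u ⟧v ρ ≡ ⟦ w ⟧v ρ
  vector-identity ρ u w ex ey ez =
    v3-cong (scalar-identity ρ (x u) (x w) ex) (scalar-identity ρ (y u) (y w) ey)
            (scalar-identity ρ (z u) (z w) ez)

ℚring : AlmostCommutativeRing 0ℓ 0ℓ
ℚring = fromCommutativeRing ℚP.+-*-commutativeRing isZero
  where
  isZero : (p : ℚ) → Maybe (0ℚ ≡ p)
  isZero p with 0ℚ ℚP.≟ p
  ... | yes eq = just eq
  ... | no _ = nothing

module ℚ³ = CoordinateSolver ℚring (λ eq → eq)
module ℤ³ = CoordinateSolver ℤSolver.ring (λ eq → eq)

module IntegerMatrices where
  open Zops
  open ℤ³ using (𝐚; 𝐛; 𝐌; env)

  private
    module S = ℤ³.Sym

    transpose-*v-dot : ∀ m r w → dot (transpose m *v r) w ≡ dot r (m *v w)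
    transpose-*v-dot m r w = ℤ³.scalar-identity (env r w zero3 m (ℤ.+ 0) (ℤ.+ 0))
      (S.dot (S.transpose 𝐌 S.*v 𝐚) 𝐛) (S.dot 𝐚 (𝐌 S.*v 𝐛)) refl

    adj-*v : ∀ m w → adj m *v (m *v w) ≡ det3 m ·v w
    adj-*v m w = ℤ³.vector-identity (env w zero3 zero3 m (ℤ.+ 0) (ℤ.+ 0))
      (S.adj 𝐌 S.*v (𝐌 S.*v 𝐚)) (S.det3 𝐌 S.·v 𝐚) refl refl refl

  *M-*v-assoc : ∀ a b w → (a *M b) *v w ≡ a *v (b *v w)
  *M-*v-assoc a b w =
    v3-cong (transpose-*v-dot b (x a) w) (transpose-*v-dot b (y a) w) (transpose-*v-dot b (z a) w)

  idM-*v : ∀ w → idM *v w ≡ w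
  idM-*v w = ℤ³.vector-identity (env w zero3 zero3 idM (ℤ.+ 0) (ℤ.+ 0)) (S.idM S.*v 𝐚) 𝐚 refl refl refl

  adj-*v-cancel : ∀ m w → InSL3 m → adj m *v (m *v w) ≡ w
  adj-*v-cancel m w det≡1 = begin
    adj m *v (m *v w)  ≡⟨ adj-*v m w ⟩
    det3 m ·v w        ≡⟨ cong (_·v w) det≡1 ⟩
    (ℤ.+ 1) ·v w       ≡⟨ v3-cong (ℤP.*-identityˡ _) (ℤP.*-identityˡ _) (ℤP.*-identityˡ _) ⟩
    w                  ∎
    where open ≡-Reasoning

  pow-suc-*v : ∀ m k w → pow m (suc k) *v w ≡ m *v (pow m k *v w)
  pow-suc-*v m k w = *M-*v-assoc m (pow m k) w

  pow-*v-comm : ∀ m k w → pow m k *v (m *v w) ≡ m *v (pow m k *v w)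
  pow-*v-comm m zero w = trans (idM-*v (m *v w)) (cong (m *v_) (sym (idM-*v w)))
  pow-*v-comm m (suc k) w = begin
    pow m (suc k) *v (m *v w)   ≡⟨ pow-suc-*v m k (m *v w) ⟩
    m *v (pow m k *v (m *v w))  ≡⟨ cong (m *v_) (pow-*v-comm m k w) ⟩
    m *v (m *v (pow m k *v w))  ≡⟨ cong (m *v_) (pow-suc-*v m k w) ⟨
    m *v (pow m (suc k) *v w)   ∎
    where open ≡-Reasoning

  pow-preserves : (P : V3 ℤ → Set) (m : M3 ℤ) → (∀ w → P w → P (m *v w)) →
    ∀ k w → P w → P (pow m k *v w)
  pow-preserves P m m-pres zero w Pw = subst P (sym (idM-*v w)) Pw
  pow-preserves P m m-pres (suc k) w Pw =
    subst P (sym (pow-suc-*v m k w)) (m-pres (pow m k *v w) (pow-preserves P m m-pres k w Pw))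

  conjugate-intertwines : ∀ d m w → InSL3 d → ((d *M m) *M adj d) *v (d *v w) ≡ d *v (m *v w)
  conjugate-intertwines d m w det≡1 =
    trans (*M-*v-assoc (d *M m) (adj d) (d *v w))
      (trans (cong ((d *M m) *v_) (adj-*v-cancel d w det≡1)) (*M-*v-assoc d m w))

open IntegerMatrices

ℤtoℚ-≃ : ∀ n → ℚ.toℚᵘ (ℤtoℚ n) ℚᵘ.≃ ℚᵘ.mkℚᵘ n 0
ℤtoℚ-≃ n = ℚP.toℚᵘ-fromℚᵘ (ℚᵘ.mkℚᵘ n 0)

ℤtoℚ-homo-+ : ∀ a b → ℤtoℚ (a ℤ.+ b) ≡ ℤtoℚ a ℚ.+ ℤtoℚ b
ℤtoℚ-homo-+ a b = ℚP.toℚᵘ-injective (begin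
  ℚ.toℚᵘ (ℤtoℚ (a ℤ.+ b))                     ≈⟨ ℤtoℚ-≃ (a ℤ.+ b) ⟩
  ℚᵘ.mkℚᵘ (a ℤ.+ b) 0
    ≈⟨ ℚᵘ.*≡* (cong (ℤ._* ℤ.+ 1) (cong₂ ℤ._+_ (sym (ℤP.*-identityʳ a)) (sym (ℤP.*-identityʳ b)))) ⟩
  ℚᵘ.mkℚᵘ a 0 ℚᵘ.+ ℚᵘ.mkℚᵘ b 0                ≈⟨ ℚᵘP.+-cong (ℤtoℚ-≃ a) (ℤtoℚ-≃ b) ⟨
  ℚ.toℚᵘ (ℤtoℚ a) ℚᵘ.+ ℚ.toℚᵘ (ℤtoℚ b)        ≈⟨ ℚP.toℚᵘ-homo-+ (ℤtoℚ a) (ℤtoℚ b) ⟨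
  ℚ.toℚᵘ (ℤtoℚ a ℚ.+ ℤtoℚ b)                  ∎)
  where open ℚᵘP.≃-Reasoning

ℤtoℚ-homo-* : ∀ a b → ℤtoℚ (a ℤ.* b) ≡ ℤtoℚ a ℚ.* ℤtoℚ b
ℤtoℚ-homo-* a b = ℚP.toℚᵘ-injective (begin
  ℚ.toℚᵘ (ℤtoℚ (a ℤ.* b))                     ≈⟨ ℤtoℚ-≃ (a ℤ.* b) ⟩
  ℚᵘ.mkℚᵘ (a ℤ.* b) 0                          ≈⟨ ℚᵘ.*≡* refl ⟩
  ℚᵘ.mkℚᵘ a 0 ℚᵘ.* ℚᵘ.mkℚᵘ b 0                ≈⟨ ℚᵘP.*-cong (ℤtoℚ-≃ a) (ℤtoℚ-≃ b) ⟨
  ℚ.toℚᵘ (ℤtoℚ a) ℚᵘ.* ℚ.toℚᵘ (ℤtoℚ b)        ≈⟨ ℚP.toℚᵘ-homo-* (ℤtoℚ a) (ℤtoℚ b) ⟨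
  ℚ.toℚᵘ (ℤtoℚ a ℚ.* ℤtoℚ b)                  ∎)
  where open ℚᵘP.≃-Reasoning

ℤtoℚ-homo‿- : ∀ a → ℤtoℚ (ℤ.- a) ≡ ℚ.- ℤtoℚ a
ℤtoℚ-homo‿- a = ℚP.toℚᵘ-injective (begin
  ℚ.toℚᵘ (ℤtoℚ (ℤ.- a))     ≈⟨ ℤtoℚ-≃ (ℤ.- a) ⟩
  ℚᵘ.-_ (ℚᵘ.mkℚᵘ a 0)       ≈⟨ ℚᵘP.-‿cong (ℤtoℚ-≃ a) ⟨
  ℚᵘ.-_ (ℚ.toℚᵘ (ℤtoℚ a))   ≈⟨ ℚP.toℚᵘ-homo‿- (ℤtoℚ a) ⟨
  ℚ.toℚᵘ (ℚ.- ℤtoℚ a)       ∎)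
  where open ℚᵘP.≃-Reasoning

open Qops
open ℚ³ using (𝐚; 𝐛; 𝐜; 𝐌; 𝐬; 𝐭; env)
open NonReflective ℚring using (solve; _⊜_; Κ; _⊕_; _⊗_; ⊝_)
private module S = ℚ³.Sym

mℤtoℚ : M3 ℤ → M3 ℚ
mℤtoℚ m = v3 (vℤtoℚ (x m)) (vℤtoℚ (y m)) (vℤtoℚ (z m))

ℤtoℚ-homo-dot : ∀ a b → ℤtoℚ (Zops.dot a b) ≡ dot (vℤtoℚ a) (vℤtoℚ b)
ℤtoℚ-homo-dot a b = begin
  ℤtoℚ ((x a ℤ.* x b ℤ.+ y a ℤ.* y b) ℤ.+ z a ℤ.* z b)
    ≡⟨ ℤtoℚ-homo-+ (x a ℤ.* x b ℤ.+ y a ℤ.* y b) (z a ℤ.* z b) ⟩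
  ℤtoℚ (x a ℤ.* x b ℤ.+ y a ℤ.* y b) ℚ.+ ℤtoℚ (z a ℤ.* z b)
    ≡⟨ cong₂ ℚ._+_ (ℤtoℚ-homo-+ (x a ℤ.* x b) (y a ℤ.* y b)) (ℤtoℚ-homo-* (z a) (z b)) ⟩
  (ℤtoℚ (x a ℤ.* x b) ℚ.+ ℤtoℚ (y a ℤ.* y b)) ℚ.+ ℤtoℚ (z a) ℚ.* ℤtoℚ (z b)
    ≡⟨ cong (ℚ._+ ℤtoℚ (z a) ℚ.* ℤtoℚ (z b))
         (cong₂ ℚ._+_ (ℤtoℚ-homo-* (x a) (x b)) (ℤtoℚ-homo-* (y a) (y b))) ⟩
  dot (vℤtoℚ a) (vℤtoℚ b) ∎
  where open ≡-Reasoning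

ℤtoℚ-homo-minor : ∀ a b c d →
  ℤtoℚ ((a ℤ.* b) Zops.- (c ℤ.* d)) ≡ (ℤtoℚ a ℚ.* ℤtoℚ b) - (ℤtoℚ c ℚ.* ℤtoℚ d)
ℤtoℚ-homo-minor a b c d = begin
  ℤtoℚ (a ℤ.* b ℤ.+ ℤ.- (c ℤ.* d))           ≡⟨ ℤtoℚ-homo-+ (a ℤ.* b) (ℤ.- (c ℤ.* d)) ⟩
  ℤtoℚ (a ℤ.* b) ℚ.+ ℤtoℚ (ℤ.- (c ℤ.* d))    ≡⟨ cong₂ ℚ._+_ (ℤtoℚ-homo-* a b) (ℤtoℚ-homo‿- (c ℤ.* d)) ⟩
  ℤtoℚ a ℚ.* ℤtoℚ b ℚ.+ ℚ.- ℤtoℚ (c ℤ.* d)   ≡⟨ cong (λ t → ℤtoℚ a ℚ.* ℤtoℚ b ℚ.+ ℚ.- t) (ℤtoℚ-homo-* c d) ⟩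
  (ℤtoℚ a ℚ.* ℤtoℚ b) - (ℤtoℚ c ℚ.* ℤtoℚ d)  ∎
  where open ≡-Reasoning

vℤtoℚ-homo-cross : ∀ a b → vℤtoℚ (Zops.cross a b) ≡ cross (vℤtoℚ a) (vℤtoℚ b)
vℤtoℚ-homo-cross a b = v3-cong (ℤtoℚ-homo-minor (y a) (z b) (z a) (y b))
  (ℤtoℚ-homo-minor (z a) (x b) (x a) (z b)) (ℤtoℚ-homo-minor (x a) (y b) (y a) (x b))

ℤtoℚ-homo-det3v : ∀ a b c → ℤtoℚ (Zops.det3v a b c) ≡ det3v (vℤtoℚ a) (vℤtoℚ b) (vℤtoℚ c)
ℤtoℚ-homo-det3v a b c =
  trans (ℤtoℚ-homo-dot a (Zops.cross b c)) (cong (dot (vℤtoℚ a)) (vℤtoℚ-homo-cross b c))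

vℤtoℚ-homo-*v : ∀ m w → vℤtoℚ (m Zops.*v w) ≡ mℤtoℚ m *v vℤtoℚ w
vℤtoℚ-homo-*v m w = v3-cong (ℤtoℚ-homo-dot (x m) w) (ℤtoℚ-homo-dot (y m) w) (ℤtoℚ-homo-dot (z m) w)

det3-mℤtoℚ : ∀ m → det3 (mℤtoℚ m) ≡ ℤtoℚ (Zops.det3 m)
det3-mℤtoℚ m = sym (ℤtoℚ-homo-det3v (x m) (y m) (z m))

cross-antisym : ∀ a b → cross b a ≡ (ℚ.- 1ℚ) ·v cross a b
cross-antisym a b = ℚ³.vector-identity (env a b zero3 idM 0ℚ 0ℚ)
  (S.cross 𝐛 𝐚) ((⊝ Κ 1ℚ) S.·v S.cross 𝐚 𝐛) refl refl refl

cross-scaleˡ : ∀ s a b → cross (s ·v a) b ≡ s ·v cross a b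
cross-scaleˡ s a b = ℚ³.vector-identity (env a b zero3 idM s 0ℚ)
  (S.cross (𝐬 S.·v 𝐚) 𝐛) (𝐬 S.·v S.cross 𝐚 𝐛) refl refl refl

cross-self : ∀ a → cross a a ≡ zero3
cross-self a = ℚ³.vector-identity (env a zero3 zero3 idM 0ℚ 0ℚ)
  (S.cross 𝐚 𝐚) S.zero3 refl refl refl

cross-cross-first : ∀ a b c → cross (cross a b) (cross a c) ≡ det3v a b c ·v a
cross-cross-first a b c = ℚ³.vector-identity (env a b c idM 0ℚ 0ℚ)
  (S.cross (S.cross 𝐚 𝐛) (S.cross 𝐚 𝐜)) (S.det3v 𝐚 𝐛 𝐜 S.·v 𝐚) refl refl refl

cross-cross-middle : ∀ a b c → cross (cross a b) (cross b c) ≡ det3v a b c ·v b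
cross-cross-middle a b c = ℚ³.vector-identity (env a b c idM 0ℚ 0ℚ)
  (S.cross (S.cross 𝐚 𝐛) (S.cross 𝐛 𝐜)) (S.det3v 𝐚 𝐛 𝐜 S.·v 𝐛) refl refl refl

cross-expand : ∀ w a b c →
  dot w b ·v cross a c ≡ ((dot w a ·v cross b c) +v (dot w c ·v cross a b)) +v ((ℚ.- det3v c a b) ·v w)
cross-expand w a b c = ℚ³.vector-identity (env a b c (v3 w zero3 zero3) 0ℚ 0ℚ)
  (S.dot (x 𝐌) 𝐛 S.·v S.cross 𝐚 𝐜)
  (((S.dot (x 𝐌) 𝐚 S.·v S.cross 𝐛 𝐜) S.+v (S.dot (x 𝐌) 𝐜 S.·v S.cross 𝐚 𝐛))
    S.+v ((⊝ S.det3v 𝐜 𝐚 𝐛) S.·v x 𝐌))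
  refl refl refl

det3v-cyclic : ∀ a b c → det3v a b c ≡ det3v b c a
det3v-cyclic a b c = ℚ³.scalar-identity (env a b c idM 0ℚ 0ℚ)
  (S.det3v 𝐚 𝐛 𝐜) (S.det3v 𝐛 𝐜 𝐚) refl

det3v-repeat : ∀ a b → det3v a a b ≡ 0ℚ
det3v-repeat a b = ℚ³.scalar-identity (env a b zero3 idM 0ℚ 0ℚ) (S.det3v 𝐚 𝐚 𝐛) (Κ 0ℚ) refl

det3v-horizontal : ∀ a b c → z a ≡ 0ℚ → z b ≡ 0ℚ → z c ≡ 0ℚ → det3v a b c ≡ 0ℚ
det3v-horizontal a b c refl refl refl = ℚ³.scalar-identity (env a b c idM 0ℚ 0ℚ)
  (S.det3v (v3 (x 𝐚) (y 𝐚) (Κ 0ℚ)) (v3 (x 𝐛) (y 𝐛) (Κ 0ℚ)) (v3 (x 𝐜) (y 𝐜) (Κ 0ℚ))) (Κ 0ℚ) refl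

det3v-*v : ∀ m a b c → det3v (m *v a) (m *v b) (m *v c) ≡ det3 m ℚ.* det3v a b c
det3v-*v m a b c = ℚ³.scalar-identity (env a b c m 0ℚ 0ℚ)
  (S.det3v (𝐌 S.*v 𝐚) (𝐌 S.*v 𝐛) (𝐌 S.*v 𝐜)) (S.det3 𝐌 ⊗ S.det3v 𝐚 𝐛 𝐜) refl

cof-*v-cross : ∀ m a b → cof m *v cross a b ≡ cross (m *v a) (m *v b)
cof-*v-cross m a b = ℚ³.vector-identity (env a b zero3 m 0ℚ 0ℚ)
  (S.cof 𝐌 S.*v S.cross 𝐚 𝐛) (S.cross (𝐌 S.*v 𝐚) (𝐌 S.*v 𝐛)) refl refl refl

adj-*v : ∀ m a → adj m *v (m *v a) ≡ det3 m ·v a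
adj-*v m a = ℚ³.vector-identity (env a zero3 zero3 m 0ℚ 0ℚ)
  (S.adj 𝐌 S.*v (𝐌 S.*v 𝐚)) (S.det3 𝐌 S.·v 𝐚) refl refl refl

*v-zero : ∀ m → m *v zero3 ≡ zero3
*v-zero m = ℚ³.vector-identity (env zero3 zero3 zero3 m 0ℚ 0ℚ) (𝐌 S.*v S.zero3) S.zero3 refl refl refl

*v-scale : ∀ m s a → m *v (s ·v a) ≡ s ·v (m *v a)
*v-scale m s a = ℚ³.vector-identity (env a zero3 zero3 m s 0ℚ)
  (𝐌 S.*v (𝐬 S.·v 𝐚)) (𝐬 S.·v (𝐌 S.*v 𝐚)) refl refl refl

scale-assoc : ∀ s t a → s ·v (t ·v a) ≡ (s ℚ.* t) ·v a
scale-assoc s t a = ℚ³.vector-identity (env a zero3 zero3 idM s t)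
  (𝐬 S.·v (𝐭 S.·v 𝐚)) ((𝐬 ⊗ 𝐭) S.·v 𝐚) refl refl refl

scale-one : ∀ a → 1ℚ ·v a ≡ a
scale-one a = ℚ³.vector-identity (env a zero3 zero3 idM 0ℚ 0ℚ) (Κ 1ℚ S.·v 𝐚) 𝐚 refl refl refl

scale-zeroˡ : ∀ a → 0ℚ ·v a ≡ zero3
scale-zeroˡ a = ℚ³.vector-identity (env a zero3 zero3 idM 0ℚ 0ℚ) (Κ 0ℚ S.·v 𝐚) S.zero3 refl refl refl

scale-zeroʳ : ∀ s → s ·v zero3 ≡ zero3
scale-zeroʳ s = ℚ³.vector-identity (env zero3 zero3 zero3 idM s 0ℚ) (𝐬 S.·v S.zero3) S.zero3 refl refl refl

dot-zeroʳ : ∀ a → dot a zero3 ≡ 0ℚ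
dot-zeroʳ a = ℚ³.scalar-identity (env a zero3 zero3 idM 0ℚ 0ℚ) (S.dot 𝐚 S.zero3) (Κ 0ℚ) refl

dot-zeroˡ : ∀ a → dot zero3 a ≡ 0ℚ
dot-zeroˡ a = ℚ³.scalar-identity (env a zero3 zero3 idM 0ℚ 0ℚ) (S.dot S.zero3 𝐚) (Κ 0ℚ) refl

cross-normalˡ : ∀ a b → dot (cross a b) a ≡ 0ℚ
cross-normalˡ a b = ℚ³.scalar-identity (env a b zero3 idM 0ℚ 0ℚ) (S.dot (S.cross 𝐚 𝐛) 𝐚) (Κ 0ℚ) refl

cross-normalʳ : ∀ a b → dot (cross a b) b ≡ 0ℚ
cross-normalʳ a b = ℚ³.scalar-identity (env a b zero3 idM 0ℚ 0ℚ) (S.dot (S.cross 𝐚 𝐛) 𝐛) (Κ 0ℚ) refl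

Nonzero : V3 ℚ → Set
Nonzero u = ¬ u ≡ zero3

*-cancelˡ-≡0 : ∀ s t → ¬ s ≡ 0ℚ → s ℚ.* t ≡ 0ℚ → t ≡ 0ℚ
*-cancelˡ-≡0 s t s≢0 st≡0 = begin
  t                    ≡⟨ ℚP.*-identityˡ t ⟨
  1ℚ ℚ.* t             ≡⟨ cong (ℚ._* t) (ℚP.*-inverseˡ s) ⟨
  (ℚ.1/ s ℚ.* s) ℚ.* t ≡⟨ ℚP.*-assoc (ℚ.1/ s) s t ⟩
  ℚ.1/ s ℚ.* (s ℚ.* t) ≡⟨ cong (ℚ.1/ s ℚ.*_) st≡0 ⟩
  ℚ.1/ s ℚ.* 0ℚ        ≡⟨ ℚP.*-zeroʳ (ℚ.1/ s) ⟩
  0ℚ                   ∎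
  where
  instance _ = ℚ.≢-nonZero s≢0
  open ≡-Reasoning

scale-cancel : ∀ s a → ¬ s ≡ 0ℚ → s ·v a ≡ zero3 → a ≡ zero3
scale-cancel s a s≢0 sa≡0 = v3-cong (*-cancelˡ-≡0 s (x a) s≢0 (cong x sa≡0))
  (*-cancelˡ-≡0 s (y a) s≢0 (cong y sa≡0)) (*-cancelˡ-≡0 s (z a) s≢0 (cong z sa≡0))

nonzero-coordinate : ∀ b → Nonzero b → Σ (V3 ℚ) λ w → ¬ dot w b ≡ 0ℚ
nonzero-coordinate b b≢0 = pick (x b ℚP.≟ 0ℚ) (y b ℚP.≟ 0ℚ) (z b ℚP.≟ 0ℚ)
  where
  idM-*v-b : idM *v b ≡ b
  idM-*v-b = ℚ³.vector-identity (env b zero3 zero3 idM 0ℚ 0ℚ) (S.idM S.*v 𝐚) 𝐚 refl refl refl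

  pick : Dec (x b ≡ 0ℚ) → Dec (y b ≡ 0ℚ) → Dec (z b ≡ 0ℚ) → Σ (V3 ℚ) λ w → ¬ dot w b ≡ 0ℚ
  pick (no bx≢0) _ _ = x idM , λ eq → bx≢0 (trans (sym (cong x idM-*v-b)) eq)
  pick (yes _) (no by≢0) _ = y idM , λ eq → by≢0 (trans (sym (cong y idM-*v-b)) eq)
  pick (yes _) (yes _) (no bz≢0) = z idM , λ eq → bz≢0 (trans (sym (cong z idM-*v-b)) eq)
  pick (yes bx≡0) (yes by≡0) (yes bz≡0) = ⊥-elim (b≢0 (v3-cong bx≡0 by≡0 bz≡0))

infix 4 _∥_ _≈ₚ_

_∥_ : V3 ℚ → V3 ℚ → Set
u ∥ w = cross u w ≡ zero3

∥-sym : ∀ u w → u ∥ w → w ∥ u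
∥-sym u w u∥w = trans (cross-antisym u w) (trans (cong ((ℚ.- 1ℚ) ·v_) u∥w) (scale-zeroʳ (ℚ.- 1ℚ)))

-- Expanding a × c along a coordinate w of b with w · b ≠ 0.
∥-trans : ∀ a b c → Nonzero b → a ∥ b → b ∥ c → a ∥ c
∥-trans a b c b≢0 a∥b b∥c = scale-cancel (dot w b) (cross a c) w·b≢0 (begin
  dot w b ·v cross a c
    ≡⟨ cross-expand w a b c ⟩
  ((dot w a ·v cross b c) +v (dot w c ·v cross a b)) +v ((ℚ.- dot c (cross a b)) ·v w)
    ≡⟨ cong₂ (λ p q → ((dot w a ·v p) +v (dot w c ·v q)) +v ((ℚ.- dot c q) ·v w)) b∥c a∥b ⟩
  ((dot w a ·v zero3) +v (dot w c ·v zero3)) +v ((ℚ.- dot c zero3) ·v w)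
    ≡⟨ ℚ³.vector-identity (env w c zero3 idM (dot w a) (dot w c))
         (((𝐬 S.·v S.zero3) S.+v (𝐭 S.·v S.zero3)) S.+v ((⊝ S.dot 𝐛 S.zero3) S.·v 𝐚)) S.zero3
         refl refl refl ⟩
  zero3 ∎)
  where
  open ≡-Reasoning
  w = proj₁ (nonzero-coordinate b b≢0)
  w·b≢0 = proj₂ (nonzero-coordinate b b≢0)

isZero3-sound : ∀ v → isZero3 v ≡ true → v ≡ zero3
isZero3-sound (v3 a b c) eq with a ℚP.≟ 0ℚ | b ℚP.≟ 0ℚ | c ℚP.≟ 0ℚ
isZero3-sound _ _  | yes refl | yes refl | yes refl = refl
isZero3-sound _ () | no _ | _ | _
isZero3-sound _ () | yes _ | no _ | _
isZero3-sound _ () | yes _ | yes _ | no _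

parallel⇒∥ : ∀ u w → parallel u w ≡ true → u ∥ w
parallel⇒∥ u w = isZero3-sound (cross u w)

∥⇒parallel : ∀ u w → u ∥ w → parallel u w ≡ true
∥⇒parallel u w u∥w = cong isZero3 u∥w

-- The building's vertices are compared through `parallel`: u ≈ₚ w says that u and w span the same
-- line, or are both zero.
record _≈ₚ_ (u w : V3 ℚ) : Set where
  constructor same-tests
  field parallel-eq : ∀ t → parallel u t ≡ parallel w t
open _≈ₚ_ public

≈ₚ-refl : ∀ {u} → u ≈ₚ u
≈ₚ-refl = same-tests λ t → refl

≈ₚ-sym : ∀ {u w} → u ≈ₚ w → w ≈ₚ u
≈ₚ-sym u≈w = same-tests λ t → sym (parallel-eq u≈w t)

≈ₚ-trans : ∀ {u v w} → u ≈ₚ v → v ≈ₚ w → u ≈ₚ w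
≈ₚ-trans u≈v v≈w = same-tests λ t → trans (parallel-eq u≈v t) (parallel-eq v≈w t)

zero-≈ₚ : ∀ {u w} → u ≡ zero3 → w ≡ zero3 → u ≈ₚ w
zero-≈ₚ refl refl = same-tests λ t → refl

∥⇒≈ₚ : ∀ {u w} → Nonzero u → Nonzero w → u ∥ w → u ≈ₚ w
∥⇒≈ₚ {u} {w} u≢0 w≢0 u∥w = same-tests λ t → ⇔→≡ {z = true} (mk⇔
  (λ u∥t → ∥⇒parallel w t (∥-trans w u t u≢0 (∥-sym u w u∥w) (parallel⇒∥ u t u∥t)))
  (λ w∥t → ∥⇒parallel u t (∥-trans u w t w≢0 u∥w (parallel⇒∥ w t w∥t))))

scale-≈ₚ : ∀ s u → ¬ s ≡ 0ℚ → s ·v u ≈ₚ u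
scale-≈ₚ s u s≢0 = same-tests λ t → ⇔→≡ {z = true} (mk⇔
  (λ su∥t → ∥⇒parallel u t (scale-cancel s (cross u t) s≢0
    (trans (sym (cross-scaleˡ s u t)) (parallel⇒∥ (s ·v u) t su∥t))))
  (λ u∥t → ∥⇒parallel (s ·v u) t
    (trans (cross-scaleˡ s u t) (trans (cong (s ·v_) (parallel⇒∥ u t u∥t)) (scale-zeroʳ s)))))

cross-antisym-≈ₚ : ∀ a b → cross b a ≈ₚ cross a b
cross-antisym-≈ₚ a b = same-tests λ t → trans (cong (λ v → parallel v t) (cross-antisym a b))
  (parallel-eq (scale-≈ₚ (ℚ.- 1ℚ) (cross a b) (λ ())) t)

-- Chains and apartment classes

infix 4 _≋_

record _≋_ (c c′ : Chain) : Set where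
  constructor same-coeffs
  field coeff-eq : ∀ e → coeff c e ≡ coeff c′ e
open _≋_ public

≋-reflexive : ∀ {c c′} → c ≡ c′ → c ≋ c′
≋-reflexive refl = same-coeffs λ e → refl

≋-sym : ∀ {c c′} → c ≋ c′ → c′ ≋ c
≋-sym c≋c′ = same-coeffs λ e → sym (coeff-eq c≋c′ e)

≋-trans : ∀ {c c′ c″} → c ≋ c′ → c′ ≋ c″ → c ≋ c″
≋-trans c≋c′ c′≋c″ = same-coeffs λ e → trans (coeff-eq c≋c′ e) (coeff-eq c′≋c″ e)

coeff-++ : ∀ c c′ e → coeff (c ++ c′) e ≡ coeff c e ℚ.+ coeff c′ e
coeff-++ [] c′ e = sym (ℚP.+-identityˡ _)
coeff-++ ((q , e′) ∷ c) c′ e with sameEdge e′ e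
... | true = trans (cong (q ℚ.+_) (coeff-++ c c′ e)) (sym (ℚP.+-assoc q _ _))
... | false = coeff-++ c c′ e

coeff-scaleC : ∀ k c e → coeff (scaleC k c) e ≡ k ℚ.* coeff c e
coeff-scaleC k [] e = sym (ℚP.*-zeroʳ k)
coeff-scaleC k ((q , e′) ∷ c) e with sameEdge e′ e
... | true = trans (cong (k ℚ.* q ℚ.+_) (coeff-scaleC k c e)) (sym (ℚP.*-distribˡ-+ k q _))
... | false = coeff-scaleC k c e

++-cong : ∀ {c₁ c₁′ c₂ c₂′} → c₁ ≋ c₁′ → c₂ ≋ c₂′ → c₁ ++ c₂ ≋ c₁′ ++ c₂′
++-cong {c₁} {c₁′} {c₂} {c₂′} c₁≋c₁′ c₂≋c₂′ = same-coeffs λ e → trans (coeff-++ c₁ c₂ e)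
  (trans (cong₂ ℚ._+_ (coeff-eq c₁≋c₁′ e) (coeff-eq c₂≋c₂′ e)) (sym (coeff-++ c₁′ c₂′ e)))

++-comm-≋ : ∀ c c′ → c ++ c′ ≋ c′ ++ c
++-comm-≋ c c′ = same-coeffs λ e →
  trans (coeff-++ c c′ e) (trans (ℚP.+-comm (coeff c e) (coeff c′ e)) (sym (coeff-++ c′ c e)))

⟦_⟧ᵇ : Bool → ℚ
⟦ true ⟧ᵇ = 1ℚ
⟦ false ⟧ᵇ = 0ℚ

coeff-as-sum : ∀ c e →
  coeff c e ≡ foldr (λ qe s → ⟦ sameEdge (proj₂ qe) e ⟧ᵇ ℚ.* proj₁ qe ℚ.+ s) 0ℚ c
coeff-as-sum [] e = refl
coeff-as-sum ((q , e′) ∷ c) e with sameEdge e′ e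
... | true = cong₂ ℚ._+_ (sym (ℚP.*-identityˡ q)) (coeff-as-sum c e)
... | false = trans (coeff-as-sum c e) (sym (trans (cong (ℚ._+ _) (ℚP.*-zeroˡ q)) (ℚP.+-identityˡ _)))

apartment : V3 ℚ → V3 ℚ → V3 ℚ → Chain
apartment u₁ u₂ u₃ =
  (1ℚ , (u₁ , cross u₁ u₂)) ∷ (ℚ.- 1ℚ , (u₂ , cross u₁ u₂)) ∷
  (1ℚ , (u₂ , cross u₂ u₃)) ∷ (ℚ.- 1ℚ , (u₃ , cross u₂ u₃)) ∷
  (1ℚ , (u₃ , cross u₃ u₁)) ∷ (ℚ.- 1ℚ , (u₁ , cross u₃ u₁)) ∷ []

hex-independent : ∀ u₁ u₂ u₃ → ¬ det3v u₁ u₂ u₃ ≡ 0ℚ → hex u₁ u₂ u₃ ≡ apartment u₁ u₂ u₃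
hex-independent u₁ u₂ u₃ det≢0 with det3v u₁ u₂ u₃ ℚP.≟ 0ℚ
... | yes det≡0 = ⊥-elim (det≢0 det≡0)
... | no _ = refl

hex-dependent : ∀ u₁ u₂ u₃ → det3v u₁ u₂ u₃ ≡ 0ℚ → hex u₁ u₂ u₃ ≡ []
hex-dependent u₁ u₂ u₃ det≡0 with det3v u₁ u₂ u₃ ℚP.≟ 0ℚ
... | yes _ = refl
... | no det≢0 = ⊥-elim (det≢0 det≡0)

-- Opaque, so that unification and the ring solver treat each ⟦ p ∧ q ⟧ᵇ as an atom.
opaque
  apartmentCoeff : (p₁ p₂ p₃ q₁₂ q₂₃ q₃₁ : Bool) → ℚ
  apartmentCoeff p₁ p₂ p₃ q₁₂ q₂₃ q₃₁ =
    ((⟦ p₁ ∧ q₁₂ ⟧ᵇ ℚ.- ⟦ p₂ ∧ q₁₂ ⟧ᵇ) ℚ.+ (⟦ p₂ ∧ q₂₃ ⟧ᵇ ℚ.- ⟦ p₃ ∧ q₂₃ ⟧ᵇ))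
      ℚ.+ (⟦ p₃ ∧ q₃₁ ⟧ᵇ ℚ.- ⟦ p₁ ∧ q₃₁ ⟧ᵇ)

opaque
  unfolding apartmentCoeff

  coeff-apartment : ∀ u₁ u₂ u₃ v n → coeff (apartment u₁ u₂ u₃) (v , n) ≡
    apartmentCoeff (parallel u₁ v) (parallel u₂ v) (parallel u₃ v)
      (parallel (cross u₁ u₂) n) (parallel (cross u₂ u₃) n) (parallel (cross u₃ u₁) n)
  coeff-apartment u₁ u₂ u₃ v n =
    let p₁ = parallel u₁ v ; p₂ = parallel u₂ v ; p₃ = parallel u₃ v
        q₁₂ = parallel (cross u₁ u₂) n ; q₂₃ = parallel (cross u₂ u₃) n ; q₃₁ = parallel (cross u₃ u₁) n
    in trans (coeff-as-sum (apartment u₁ u₂ u₃) (v , n))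
      (solve 6 (λ t₁ t₂ t₃ t₄ t₅ t₆ →
           (t₁ ⊗ Κ 1ℚ ⊕ (t₂ ⊗ Κ (ℚ.- 1ℚ) ⊕ (t₃ ⊗ Κ 1ℚ ⊕ (t₄ ⊗ Κ (ℚ.- 1ℚ) ⊕
             (t₅ ⊗ Κ 1ℚ ⊕ (t₆ ⊗ Κ (ℚ.- 1ℚ) ⊕ Κ 0ℚ))))))
         ⊜ (((t₁ ⊕ ⊝ t₂) ⊕ (t₃ ⊕ ⊝ t₄)) ⊕ (t₅ ⊕ ⊝ t₆)))
         refl ⟦ p₁ ∧ q₁₂ ⟧ᵇ ⟦ p₂ ∧ q₁₂ ⟧ᵇ ⟦ p₂ ∧ q₂₃ ⟧ᵇ ⟦ p₃ ∧ q₂₃ ⟧ᵇ ⟦ p₃ ∧ q₃₁ ⟧ᵇ ⟦ p₁ ∧ q₃₁ ⟧ᵇ)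

  apartmentCoeff-rotate : ∀ p₁ p₂ p₃ q₁₂ q₂₃ q₃₁ →
    apartmentCoeff p₁ p₂ p₃ q₁₂ q₂₃ q₃₁ ≡ apartmentCoeff p₂ p₃ p₁ q₂₃ q₃₁ q₁₂
  apartmentCoeff-rotate p₁ p₂ p₃ q₁₂ q₂₃ q₃₁ =
    solve 6 (λ t₁ t₂ t₃ t₄ t₅ t₆ →
        (((t₁ ⊕ ⊝ t₂) ⊕ (t₃ ⊕ ⊝ t₄)) ⊕ (t₅ ⊕ ⊝ t₆)) ⊜ (((t₃ ⊕ ⊝ t₄) ⊕ (t₅ ⊕ ⊝ t₆)) ⊕ (t₁ ⊕ ⊝ t₂)))
      refl ⟦ p₁ ∧ q₁₂ ⟧ᵇ ⟦ p₂ ∧ q₁₂ ⟧ᵇ ⟦ p₂ ∧ q₂₃ ⟧ᵇ ⟦ p₃ ∧ q₂₃ ⟧ᵇ ⟦ p₃ ∧ q₃₁ ⟧ᵇ ⟦ p₁ ∧ q₃₁ ⟧ᵇ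

  apartmentCoeff-line-repeated : ∀ p p₃ q₁₂ q₂₃ → apartmentCoeff p p p₃ q₁₂ q₂₃ q₂₃ ≡ 0ℚ
  apartmentCoeff-line-repeated p p₃ q₁₂ q₂₃ =
    solve 3 (λ t₁ t₂ t₃ → (((t₁ ⊕ ⊝ t₁) ⊕ (t₂ ⊕ ⊝ t₃)) ⊕ (t₃ ⊕ ⊝ t₂)) ⊜ Κ 0ℚ)
      refl ⟦ p ∧ q₁₂ ⟧ᵇ ⟦ p ∧ q₂₃ ⟧ᵇ ⟦ p₃ ∧ q₂₃ ⟧ᵇ

  apartmentCoeff-plane-constant : ∀ p₁ p₂ p₃ q → apartmentCoeff p₁ p₂ p₃ q q q ≡ 0ℚ
  apartmentCoeff-plane-constant p₁ p₂ p₃ q =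
    solve 3 (λ t₁ t₂ t₃ → (((t₁ ⊕ ⊝ t₂) ⊕ (t₂ ⊕ ⊝ t₃)) ⊕ (t₃ ⊕ ⊝ t₁)) ⊜ Κ 0ℚ)
      refl ⟦ p₁ ∧ q ⟧ᵇ ⟦ p₂ ∧ q ⟧ᵇ ⟦ p₃ ∧ q ⟧ᵇ

  apartmentCoeff-cocycle : ∀ pf py py′ pc qfy qyc qcf qfy′ qy′c qyy′ →
    apartmentCoeff pf py′ pc qfy′ qy′c qcf ≡
    (apartmentCoeff pf py pc qfy qyc qcf ℚ.+ apartmentCoeff py py′ pc qyy′ qy′c qyc)
      ℚ.- apartmentCoeff pf py py′ qfy qyy′ qfy′
  apartmentCoeff-cocycle pf py py′ pc qfy qyc qcf qfy′ qy′c qyy′ =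
    solve 12 (λ f₁ f₂ f₃ f₄ f₅ f₆ y₁ y₂ y₃ y₄ y₅ y₆ →
        (((f₁ ⊕ ⊝ y₁) ⊕ (y₂ ⊕ ⊝ y₃)) ⊕ (f₅ ⊕ ⊝ f₆))
      ⊜ (((((f₂ ⊕ ⊝ f₃) ⊕ (f₄ ⊕ ⊝ y₆)) ⊕ (f₅ ⊕ ⊝ f₆))
          ⊕ (((y₄ ⊕ ⊝ y₅) ⊕ (y₂ ⊕ ⊝ y₃)) ⊕ (y₆ ⊕ ⊝ f₄)))
         ⊕ ⊝ (((f₂ ⊕ ⊝ f₃) ⊕ (y₄ ⊕ ⊝ y₅)) ⊕ (y₁ ⊕ ⊝ f₁))))
      refl
      ⟦ pf ∧ qfy′ ⟧ᵇ ⟦ pf ∧ qfy ⟧ᵇ ⟦ py ∧ qfy ⟧ᵇ ⟦ py ∧ qyc ⟧ᵇ ⟦ pc ∧ qcf ⟧ᵇ ⟦ pf ∧ qcf ⟧ᵇ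
      ⟦ py′ ∧ qfy′ ⟧ᵇ ⟦ py′ ∧ qy′c ⟧ᵇ ⟦ pc ∧ qy′c ⟧ᵇ ⟦ py ∧ qyy′ ⟧ᵇ ⟦ py′ ∧ qyy′ ⟧ᵇ ⟦ pc ∧ qyc ⟧ᵇ

apartment-rotate : ∀ u₁ u₂ u₃ → apartment u₁ u₂ u₃ ≋ apartment u₂ u₃ u₁
apartment-rotate u₁ u₂ u₃ = same-coeffs λ (v , n) → trans (coeff-apartment u₁ u₂ u₃ v n)
  (trans (apartmentCoeff-rotate _ _ _ _ _ _) (sym (coeff-apartment u₂ u₃ u₁ v n)))

apartment-cong : ∀ {u₁ u₂ u₃ w₁ w₂ w₃} → u₁ ≈ₚ w₁ → u₂ ≈ₚ w₂ → u₃ ≈ₚ w₃ →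
  cross u₁ u₂ ≈ₚ cross w₁ w₂ → cross u₂ u₃ ≈ₚ cross w₂ w₃ → cross u₃ u₁ ≈ₚ cross w₃ w₁ →
  apartment u₁ u₂ u₃ ≋ apartment w₁ w₂ w₃
apartment-cong {u₁} {u₂} {u₃} {w₁} {w₂} {w₃} l₁ l₂ l₃ p₁₂ p₂₃ p₃₁ = same-coeffs λ (v , n) → begin
  coeff (apartment u₁ u₂ u₃) (v , n)        ≡⟨ coeff-apartment u₁ u₂ u₃ v n ⟩
  apartmentCoeff (parallel u₁ v) (parallel u₂ v) (parallel u₃ v)
    (parallel (cross u₁ u₂) n) (parallel (cross u₂ u₃) n) (parallel (cross u₃ u₁) n)
    ≡⟨ cong₃ (λ p₁ p₂ p₃ → apartmentCoeff p₁ p₂ p₃ _ _ _)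
         (parallel-eq l₁ v) (parallel-eq l₂ v) (parallel-eq l₃ v) ⟩
  apartmentCoeff (parallel w₁ v) (parallel w₂ v) (parallel w₃ v)
    (parallel (cross u₁ u₂) n) (parallel (cross u₂ u₃) n) (parallel (cross u₃ u₁) n)
    ≡⟨ cong₃ (apartmentCoeff _ _ _) (parallel-eq p₁₂ n) (parallel-eq p₂₃ n) (parallel-eq p₃₁ n) ⟩
  apartmentCoeff (parallel w₁ v) (parallel w₂ v) (parallel w₃ v)
    (parallel (cross w₁ w₂) n) (parallel (cross w₂ w₃) n) (parallel (cross w₃ w₁) n)
    ≡⟨ coeff-apartment w₁ w₂ w₃ v n ⟨
  coeff (apartment w₁ w₂ w₃) (v , n)        ∎
  where
  open ≡-Reasoning
  cong₃ : ∀ {A : Set} (f : Bool → Bool → Bool → A) {a b c a′ b′ c′} →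
    a ≡ a′ → b ≡ b′ → c ≡ c′ → f a b c ≡ f a′ b′ c′
  cong₃ f refl refl refl = refl

coplanar⇒normals-∥ : ∀ a b c → det3v a b c ≡ 0ℚ → cross a b ∥ cross b c
coplanar⇒normals-∥ a b c det≡0 =
  trans (cross-cross-middle a b c) (trans (cong (_·v b) det≡0) (scale-zeroˡ b))

coplanar⇒same-plane : ∀ a b c → Nonzero (cross a b) → Nonzero (cross b c) →
  det3v a b c ≡ 0ℚ → cross a b ≈ₚ cross b c
coplanar⇒same-plane a b c ab≢0 bc≢0 det≡0 = ∥⇒≈ₚ ab≢0 bc≢0 (coplanar⇒normals-∥ a b c det≡0)

non-parallel⇒cross-nonzero : ∀ a b → parallel a b ≡ false → Nonzero (cross a b)
non-parallel⇒cross-nonzero a b a∦b a∥b with () ← trans (sym a∦b) (∥⇒parallel a b a∥b)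

apartment-dependent-with-parallel-edge : ∀ u₁ u₂ u₃ → Nonzero u₁ → Nonzero u₂ →
  det3v u₁ u₂ u₃ ≡ 0ℚ → u₁ ∥ u₂ → apartment u₁ u₂ u₃ ≋ []
apartment-dependent-with-parallel-edge u₁ u₂ u₃ u₁≢0 u₂≢0 det≡0 u₁∥u₂ =
  same-coeffs λ (v , n) → begin
  coeff (apartment u₁ u₂ u₃) (v , n)
    ≡⟨ coeff-apartment u₁ u₂ u₃ v n ⟩
  apartmentCoeff (parallel u₁ v) (parallel u₂ v) (parallel u₃ v)
    (parallel (cross u₁ u₂) n) (parallel (cross u₂ u₃) n) (parallel (cross u₃ u₁) n)
    ≡⟨ cong₂ (λ p q → apartmentCoeff p (parallel u₂ v) (parallel u₃ v) (parallel (cross u₁ u₂) n)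
                       (parallel (cross u₂ u₃) n) q)
         (parallel-eq (∥⇒≈ₚ u₁≢0 u₂≢0 u₁∥u₂) v) (parallel-eq same-plane n) ⟩
  apartmentCoeff (parallel u₂ v) (parallel u₂ v) (parallel u₃ v)
    (parallel (cross u₁ u₂) n) (parallel (cross u₂ u₃) n) (parallel (cross u₂ u₃) n)
    ≡⟨ apartmentCoeff-line-repeated _ _ _ _ ⟩
  0ℚ ∎
  where
  open ≡-Reasoning
  same-plane : cross u₃ u₁ ≈ₚ cross u₂ u₃
  same-plane with parallel u₂ u₃ in u₂?u₃
  ... | true = zero-≈ₚ (∥-sym u₁ u₃ (∥-trans u₁ u₂ u₃ u₂≢0 u₁∥u₂ u₂∥u₃)) u₂∥u₃
    where u₂∥u₃ = parallel⇒∥ u₂ u₃ u₂?u₃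
  ... | false = ≈ₚ-sym (coplanar⇒same-plane u₂ u₃ u₁ u₂×u₃≢0 u₃×u₁≢0
                   (trans (sym (det3v-cyclic u₁ u₂ u₃)) det≡0))
    where
    u₂×u₃≢0 = non-parallel⇒cross-nonzero u₂ u₃ u₂?u₃
    u₃×u₁≢0 : Nonzero (cross u₃ u₁)
    u₃×u₁≢0 u₃∥u₁ = u₂×u₃≢0 (∥-trans u₂ u₁ u₃ u₁≢0 (∥-sym u₁ u₂ u₁∥u₂) (∥-sym u₃ u₁ u₃∥u₁))

apartment-dependent-without-parallel-edge : ∀ u₁ u₂ u₃ →
  Nonzero (cross u₁ u₂) → Nonzero (cross u₂ u₃) → Nonzero (cross u₃ u₁) →
  det3v u₁ u₂ u₃ ≡ 0ℚ → apartment u₁ u₂ u₃ ≋ []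
apartment-dependent-without-parallel-edge u₁ u₂ u₃ u₁×u₂≢0 u₂×u₃≢0 u₃×u₁≢0 det≡0 =
  same-coeffs λ (v , n) → begin
  coeff (apartment u₁ u₂ u₃) (v , n)
    ≡⟨ coeff-apartment u₁ u₂ u₃ v n ⟩
  apartmentCoeff (parallel u₁ v) (parallel u₂ v) (parallel u₃ v)
    (parallel (cross u₁ u₂) n) (parallel (cross u₂ u₃) n) (parallel (cross u₃ u₁) n)
    ≡⟨ cong₂ (λ p q → apartmentCoeff (parallel u₁ v) (parallel u₂ v) (parallel u₃ v)
                       p (parallel (cross u₂ u₃) n) q)
         (parallel-eq (coplanar⇒same-plane u₁ u₂ u₃ u₁×u₂≢0 u₂×u₃≢0 det≡0) n)
         (parallel-eq (≈ₚ-sym (coplanar⇒same-plane u₂ u₃ u₁ u₂×u₃≢0 u₃×u₁≢0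
           (trans (sym (det3v-cyclic u₁ u₂ u₃)) det≡0))) n) ⟩
  apartmentCoeff (parallel u₁ v) (parallel u₂ v) (parallel u₃ v)
    (parallel (cross u₂ u₃) n) (parallel (cross u₂ u₃) n) (parallel (cross u₂ u₃) n)
    ≡⟨ apartmentCoeff-plane-constant _ _ _ _ ⟩
  0ℚ ∎
  where open ≡-Reasoning

apartment-dependent : ∀ u₁ u₂ u₃ → Nonzero u₁ → Nonzero u₂ → Nonzero u₃ →
  det3v u₁ u₂ u₃ ≡ 0ℚ → apartment u₁ u₂ u₃ ≋ []
apartment-dependent u₁ u₂ u₃ u₁≢0 u₂≢0 u₃≢0 det≡0
  with parallel u₁ u₂ in u₁?u₂ | parallel u₂ u₃ in u₂?u₃ | parallel u₃ u₁ in u₃?u₁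
... | true | _ | _ =
  apartment-dependent-with-parallel-edge u₁ u₂ u₃ u₁≢0 u₂≢0 det≡0 (parallel⇒∥ u₁ u₂ u₁?u₂)
... | false | true | _ = ≋-trans (apartment-rotate u₁ u₂ u₃)
  (apartment-dependent-with-parallel-edge u₂ u₃ u₁ u₂≢0 u₃≢0 det₂₃₁≡0 (parallel⇒∥ u₂ u₃ u₂?u₃))
  where det₂₃₁≡0 = trans (sym (det3v-cyclic u₁ u₂ u₃)) det≡0
... | false | false | true = ≋-trans (apartment-rotate u₁ u₂ u₃) (≋-trans (apartment-rotate u₂ u₃ u₁)
  (apartment-dependent-with-parallel-edge u₃ u₁ u₂ u₃≢0 u₁≢0 det₃₁₂≡0 (parallel⇒∥ u₃ u₁ u₃?u₁)))
  where det₃₁₂≡0 = trans (sym (det3v-cyclic u₂ u₃ u₁)) (trans (sym (det3v-cyclic u₁ u₂ u₃)) det≡0)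
... | false | false | false = apartment-dependent-without-parallel-edge u₁ u₂ u₃
  (non-parallel⇒cross-nonzero u₁ u₂ u₁?u₂) (non-parallel⇒cross-nonzero u₂ u₃ u₂?u₃)
  (non-parallel⇒cross-nonzero u₃ u₁ u₃?u₁) det≡0

hex≋apartment : ∀ u₁ u₂ u₃ → Nonzero u₁ → Nonzero u₂ → Nonzero u₃ →
  hex u₁ u₂ u₃ ≋ apartment u₁ u₂ u₃
hex≋apartment u₁ u₂ u₃ u₁≢0 u₂≢0 u₃≢0 with det3v u₁ u₂ u₃ ℚP.≟ 0ℚ
... | yes det≡0 = ≋-sym (apartment-dependent u₁ u₂ u₃ u₁≢0 u₂≢0 u₃≢0 det≡0)
... | no _ = same-coeffs λ e → refl

span-cong-≈ₚ : ∀ a c c′ → Nonzero c → Nonzero c′ → c′ ∥ c → cross a c′ ≈ₚ cross a c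
span-cong-≈ₚ a c c′ c≢0 c′≢0 c′∥c with parallel a c in a?c
... | true = zero-≈ₚ (∥-trans a c c′ c≢0 a∥c (∥-sym c′ c c′∥c)) a∥c
  where a∥c = parallel⇒∥ a c a?c
... | false = ∥⇒≈ₚ a×c′≢0 a×c≢0 (begin
  cross (cross a c′) (cross a c)  ≡⟨ cross-cross-first a c′ c ⟩
  det3v a c′ c ·v a               ≡⟨ cong (λ t → dot a t ·v a) c′∥c ⟩
  dot a zero3 ·v a                ≡⟨ cong (_·v a) (dot-zeroʳ a) ⟩
  0ℚ ·v a                         ≡⟨ scale-zeroˡ a ⟩
  zero3                           ∎)
  where
  open ≡-Reasoning
  a×c≢0 = non-parallel⇒cross-nonzero a c a?c
  a×c′≢0 : Nonzero (cross a c′)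
  a×c′≢0 a∥c′ = a×c≢0 (∥-trans a c′ c c′≢0 a∥c′ c′∥c)

apartment-cocycle : ∀ f y y′ c → Nonzero f → Nonzero y → Nonzero y′ → det3v f y y′ ≡ 0ℚ →
  apartment f y′ c ≋ apartment f y c ++ apartment y y′ c
apartment-cocycle f y y′ c f≢0 y≢0 y′≢0 det≡0 = same-coeffs coeffs
  where
  coeffs : ∀ e → coeff (apartment f y′ c) e ≡ coeff (apartment f y c ++ apartment y y′ c) e
  coeffs (v , n) = begin
    coeff (apartment f y′ c) (v , n)
      ≡⟨ coeff-apartment f y′ c v n ⟩
    apartmentCoeff pf py′ pc qfy′ qy′c qcf
      ≡⟨ apartmentCoeff-cocycle pf py py′ pc qfy qyc qcf qfy′ qy′c qyy′ ⟩
    (apartmentCoeff pf py pc qfy qyc qcf ℚ.+ apartmentCoeff py py′ pc qyy′ qy′c qyc)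
      ℚ.- apartmentCoeff pf py py′ qfy qyy′ qfy′
      ≡⟨ cong₂ (λ s t → (apartmentCoeff pf py pc qfy qyc qcf ℚ.+ apartmentCoeff py py′ pc qyy′ qy′c s)
                          ℚ.- apartmentCoeff pf py py′ qfy qyy′ t)
           (parallel-eq (cross-antisym-≈ₚ c y) n) (parallel-eq (cross-antisym-≈ₚ y′ f) n) ⟩
    (apartmentCoeff pf py pc qfy qyc qcf ℚ.+ apartmentCoeff py py′ pc qyy′ qy′c (parallel (cross c y) n))
      ℚ.- apartmentCoeff pf py py′ qfy qyy′ (parallel (cross y′ f) n)
      ≡⟨ cong₂ (λ s t → s ℚ.- t)
           (cong₂ ℚ._+_ (coeff-apartment f y c v n) (coeff-apartment y y′ c v n))
           (coeff-apartment f y y′ v n) ⟨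
    (coeff (apartment f y c) (v , n) ℚ.+ coeff (apartment y y′ c) (v , n))
      ℚ.- coeff (apartment f y y′) (v , n)
      ≡⟨ cong (λ t → (coeff (apartment f y c) (v , n) ℚ.+ coeff (apartment y y′ c) (v , n)) ℚ.- t)
           (coeff-eq (apartment-dependent f y y′ f≢0 y≢0 y′≢0 det≡0) (v , n)) ⟩
    (coeff (apartment f y c) (v , n) ℚ.+ coeff (apartment y y′ c) (v , n)) ℚ.- 0ℚ
      ≡⟨ ℚP.+-identityʳ _ ⟩
    coeff (apartment f y c) (v , n) ℚ.+ coeff (apartment y y′ c) (v , n)
      ≡⟨ coeff-++ (apartment f y c) (apartment y y′ c) (v , n) ⟨
    coeff (apartment f y c ++ apartment y y′ c) (v , n) ∎
    where
    open ≡-Reasoning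
    pf = parallel f v
    py = parallel y v
    py′ = parallel y′ v
    pc = parallel c v
    qfy = parallel (cross f y) n
    qyc = parallel (cross y c) n
    qcf = parallel (cross c f) n
    qfy′ = parallel (cross f y′) n
    qy′c = parallel (cross y′ c) n
    qyy′ = parallel (cross y y′) n

independent⇒nonzero : ∀ a b c → ¬ det3v a b c ≡ 0ℚ → Nonzero a × Nonzero (cross b c)
independent⇒nonzero a b c det≢0 =
  (λ a≡0 → det≢0 (trans (cong (λ t → dot t (cross b c)) a≡0) (dot-zeroˡ (cross b c)))) ,
  (λ b×c≡0 → det≢0 (trans (cong (dot a) b×c≡0) (dot-zeroʳ a)))

hex-InSt : ∀ u₁ u₂ u₃ → InSt (hex u₁ u₂ u₃)
hex-InSt u₁ u₂ u₃ with det3v u₁ u₂ u₃ ℚP.≟ 0ℚ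
... | yes _ = [] , (λ _ _ → refl) , (λ _ _ → refl)
... | no det≢0 = edges , lines , planes
  where
  det₂₃₁≢0 = λ eq → det≢0 (trans (det3v-cyclic u₁ u₂ u₃) eq)
  det₃₁₂≢0 = λ eq → det₂₃₁≢0 (trans (det3v-cyclic u₂ u₃ u₁) eq)
  u₁≢0 = proj₁ (independent⇒nonzero u₁ u₂ u₃ det≢0)
  u₂≢0 = proj₁ (independent⇒nonzero u₂ u₃ u₁ det₂₃₁≢0)
  u₃≢0 = proj₁ (independent⇒nonzero u₃ u₁ u₂ det₃₁₂≢0)
  u₂×u₃≢0 = proj₂ (independent⇒nonzero u₁ u₂ u₃ det≢0)
  u₃×u₁≢0 = proj₂ (independent⇒nonzero u₂ u₃ u₁ det₂₃₁≢0)
  u₁×u₂≢0 = proj₂ (independent⇒nonzero u₃ u₁ u₂ det₃₁₂≢0)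

  edges : WFChain (apartment u₁ u₂ u₃)
  edges = (u₁≢0 , u₁×u₂≢0 , cross-normalˡ u₁ u₂) ∷ (u₂≢0 , u₁×u₂≢0 , cross-normalʳ u₁ u₂) ∷
          (u₂≢0 , u₂×u₃≢0 , cross-normalˡ u₂ u₃) ∷ (u₃≢0 , u₂×u₃≢0 , cross-normalʳ u₂ u₃) ∷
          (u₃≢0 , u₃×u₁≢0 , cross-normalˡ u₃ u₁) ∷ (u₁≢0 , u₃×u₁≢0 , cross-normalʳ u₃ u₁) ∷ []

  lines : ∀ w → Nonzero w → lineCoeff∂ (apartment u₁ u₂ u₃) w ≡ 0ℚ
  lines w _ with parallel u₁ w | parallel u₂ w | parallel u₃ w
  ... | true  | true  | true  = refl
  ... | true  | true  | false = refl
  ... | true  | false | true  = refl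
  ... | true  | false | false = refl
  ... | false | true  | true  = refl
  ... | false | true  | false = refl
  ... | false | false | true  = refl
  ... | false | false | false = refl

  planes : ∀ w → Nonzero w → planeCoeff∂ (apartment u₁ u₂ u₃) w ≡ 0ℚ
  planes w _ with parallel (cross u₁ u₂) w | parallel (cross u₂ u₃) w | parallel (cross u₃ u₁) w
  ... | true  | true  | true  = refl
  ... | true  | true  | false = refl
  ... | true  | false | true  = refl
  ... | true  | false | false = refl
  ... | false | true  | true  = refl
  ... | false | true  | false = refl
  ... | false | false | true  = refl
  ... | false | false | false = refl

hex-split : ∀ f y y′ c c′ → Nonzero f → Nonzero y → Nonzero y′ → Nonzero c → Nonzero c′ →
  det3v f y y′ ≡ 0ℚ → c′ ∥ c → hex f y′ c ≋ hex f y c ++ hex y y′ c′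
hex-split f y y′ c c′ f≢0 y≢0 y′≢0 c≢0 c′≢0 det≡0 c′∥c =
  ≋-trans (hex≋apartment f y′ c f≢0 y′≢0 c≢0)
    (≋-trans (apartment-cocycle f y y′ c f≢0 y≢0 y′≢0 det≡0)
      (≋-sym (++-cong (hex≋apartment f y c f≢0 y≢0 c≢0) second-class)))
  where
  c′y≈cy = ≈ₚ-trans (cross-antisym-≈ₚ y c′)
    (≈ₚ-trans (span-cong-≈ₚ y c c′ c≢0 c′≢0 c′∥c) (cross-antisym-≈ₚ c y))
  second-class : hex y y′ c′ ≋ apartment y y′ c
  second-class = ≋-trans (hex≋apartment y y′ c′ y≢0 y′≢0 c′≢0)
    (apartment-cong ≈ₚ-refl ≈ₚ-refl (∥⇒≈ₚ c′≢0 c≢0 c′∥c) ≈ₚ-refl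
      (span-cong-≈ₚ y′ c c′ c≢0 c′≢0 c′∥c) c′y≈cy)

-- The action of SL₃(ℤ)

actC-apartment : ∀ g a b c →
  actC g (apartment a b c) ≡ apartment (mℤtoℚ g *v a) (mℤtoℚ g *v b) (mℤtoℚ g *v c)
actC-apartment g a b c = cong₃ hexagon (cof-*v-cross m a b) (cof-*v-cross m b c) (cof-*v-cross m c a)
  where
  m = mℤtoℚ g
  hexagon : V3 ℚ → V3 ℚ → V3 ℚ → Chain
  hexagon n₁₂ n₂₃ n₃₁ =
    (1ℚ , (m *v a , n₁₂)) ∷ (ℚ.- 1ℚ , (m *v b , n₁₂)) ∷
    (1ℚ , (m *v b , n₂₃)) ∷ (ℚ.- 1ℚ , (m *v c , n₂₃)) ∷
    (1ℚ , (m *v c , n₃₁)) ∷ (ℚ.- 1ℚ , (m *v a , n₃₁)) ∷ []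
  cong₃ : ∀ (f : V3 ℚ → V3 ℚ → V3 ℚ → Chain) {p q r p′ q′ r′} →
    p ≡ p′ → q ≡ q′ → r ≡ r′ → f p q r ≡ f p′ q′ r′
  cong₃ f refl refl refl = refl

actC-hex : ∀ g a b c → ¬ det3 (mℤtoℚ g) ≡ 0ℚ →
  actC g (hex a b c) ≡ hex (mℤtoℚ g *v a) (mℤtoℚ g *v b) (mℤtoℚ g *v c)
actC-hex g a b c det-g≢0 with det3v a b c ℚP.≟ 0ℚ
... | yes det≡0 = sym (hex-dependent _ _ _
  (trans (det3v-*v m a b c) (trans (cong (det3 m ℚ.*_) det≡0) (ℚP.*-zeroʳ (det3 m)))))
  where m = mℤtoℚ g
... | no det≢0 = trans (actC-apartment g a b c) (sym (hex-independent _ _ _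
  λ eq → det≢0 (*-cancelˡ-≡0 (det3 m) (det3v a b c) det-g≢0 (trans (sym (det3v-*v m a b c)) eq))))
  where m = mℤtoℚ g

SL-det3-nonzero : ∀ g → InSL3 g → ¬ det3 (mℤtoℚ g) ≡ 0ℚ
SL-det3-nonzero g g∈SL det≡0 with () ← trans (sym (cong ℤtoℚ g∈SL)) (trans (sym (det3-mℤtoℚ g)) det≡0)

actC-hexℤ : ∀ g a b c → InSL3 g →
  actC g (hexℤ a b c) ≡ hexℤ (g Zops.*v a) (g Zops.*v b) (g Zops.*v c)
actC-hexℤ g a b c g∈SL = begin
  actC g (hexℤ a b c)
    ≡⟨ actC-hex g (vℤtoℚ a) (vℤtoℚ b) (vℤtoℚ c) (SL-det3-nonzero g g∈SL) ⟩
  hex (mℤtoℚ g *v vℤtoℚ a) (mℤtoℚ g *v vℤtoℚ b) (mℤtoℚ g *v vℤtoℚ c)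
    ≡⟨ cong₂ (λ p (qr : V3 ℚ × V3 ℚ) → hex p (proj₁ qr) (proj₂ qr)) (vℤtoℚ-homo-*v g a)
         (cong₂ _,_ (vℤtoℚ-homo-*v g b) (vℤtoℚ-homo-*v g c)) ⟨
  hexℤ (g Zops.*v a) (g Zops.*v b) (g Zops.*v c) ∎
  where open ≡-Reasoning

*v-nonzero : ∀ m u → ¬ det3 m ≡ 0ℚ → Nonzero u → Nonzero (m *v u)
*v-nonzero m u det≢0 u≢0 mu≡0 = u≢0 (scale-cancel (det3 m) u det≢0 (begin
  det3 m ·v u         ≡⟨ adj-*v m u ⟨
  adj m *v (m *v u)   ≡⟨ cong (adj m *v_) mu≡0 ⟩
  adj m *v zero3      ≡⟨ *v-zero (adj m) ⟩
  zero3               ∎))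
  where open ≡-Reasoning

SL-nonzero : ∀ g x → InSL3 g → Nonzero (vℤtoℚ x) → Nonzero (vℤtoℚ (g Zops.*v x))
SL-nonzero g x g∈SL x≢0 gx≡0 = *v-nonzero (mℤtoℚ g) (vℤtoℚ x)
  (SL-det3-nonzero g g∈SL) x≢0 (trans (sym (vℤtoℚ-homo-*v g x)) gx≡0)

-- Coinvariants and the telescoping sum

orbitSum : M3 ℤ → Chain → ℕ → Chain
orbitSum γ z zero = []
orbitSum γ z (suc m) = actC (Zops.pow γ m) z ++ orbitSum γ z m

coeff-minus-scaled : ∀ c k z e → coeff (c ++ negC (scaleC k z)) e ≡ coeff c e ℚ.- k ℚ.* coeff z e
coeff-minus-scaled c k z e = begin
  coeff (c ++ negC (scaleC k z)) e
    ≡⟨ coeff-++ c (negC (scaleC k z)) e ⟩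
  coeff c e ℚ.+ coeff (negC (scaleC k z)) e
    ≡⟨ cong (coeff c e ℚ.+_) (coeff-scaleC (ℚ.- 1ℚ) (scaleC k z) e) ⟩
  coeff c e ℚ.+ (ℚ.- 1ℚ) ℚ.* coeff (scaleC k z) e
    ≡⟨ cong (λ t → coeff c e ℚ.+ (ℚ.- 1ℚ) ℚ.* t) (coeff-scaleC k z e) ⟩
  coeff c e ℚ.+ (ℚ.- 1ℚ) ℚ.* (k ℚ.* coeff z e)
    ≡⟨ solve 3 (λ c k z → (c ⊕ (⊝ Κ 1ℚ) ⊗ (k ⊗ z)) ⊜ (c ⊕ ⊝ (k ⊗ z))) refl (coeff c e) k (coeff z e) ⟩
  coeff c e ℚ.- k ℚ.* coeff z e ∎
  where open ≡-Reasoning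

coinvariant-orbitSum : ∀ (Γ : M3 ℤ → Set) γ z → (∀ k → Γ (Zops.pow γ k)) → InSt z →
  ∀ m → CoinvEq Γ (orbitSum γ z m) (scaleC (ℤ.+ m ℚ./ 1) z)
coinvariant-orbitSum Γ γ z γᵏ∈Γ z∈St m = witnesses m , witnesses-valid m ,
  λ e _ → trans (coeff-minus-scaled (orbitSum γ z m) (ℤtoℚ (ℤ.+ m)) z e) (sym (coeff-witnesses m e))
  where
  witnesses : ℕ → List (M3 ℤ × Chain)
  witnesses zero = []
  witnesses (suc k) = (Zops.pow γ k , z) ∷ witnesses k

  witnesses-valid : ∀ m → All (λ w → Γ (proj₁ w) × InSt (proj₂ w)) (witnesses m)
  witnesses-valid zero = []
  witnesses-valid (suc k) = (γᵏ∈Γ k , z∈St) ∷ witnesses-valid k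

  T : M3 ℤ × Chain → Chain
  T w = actC (proj₁ w) (proj₂ w) ++ negC (proj₂ w)

  coeff-witnesses : ∀ m e →
    coeff (concatMap T (witnesses m)) e
      ≡ coeff (orbitSum γ z m) e ℚ.- ℤtoℚ (ℤ.+ m) ℚ.* coeff z e
  coeff-witnesses zero e = sym (solve 1 (λ z → (Κ 0ℚ ⊕ ⊝ (Κ 0ℚ ⊗ z)) ⊜ Κ 0ℚ) refl (coeff z e))
  coeff-witnesses (suc k) e = begin
    coeff ((actC γᵏ z ++ negC z) ++ concatMap T (witnesses k)) e
      ≡⟨ coeff-++ (actC γᵏ z ++ negC z) (concatMap T (witnesses k)) e ⟩
    coeff (actC γᵏ z ++ negC z) e ℚ.+ coeff (concatMap T (witnesses k)) e
      ≡⟨ cong₂ ℚ._+_ (trans (coeff-++ (actC γᵏ z) (negC z) e)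
                       (cong (coeff (actC γᵏ z) e ℚ.+_) (coeff-scaleC (ℚ.- 1ℚ) z e)))
                     (coeff-witnesses k e) ⟩
    (coeff (actC γᵏ z) e ℚ.+ (ℚ.- 1ℚ) ℚ.* coeff z e)
      ℚ.+ (coeff (orbitSum γ z k) e ℚ.- ℤtoℚ (ℤ.+ k) ℚ.* coeff z e)
      ≡⟨ solve 4 (λ A Z O n → ((A ⊕ (⊝ Κ 1ℚ) ⊗ Z) ⊕ (O ⊕ ⊝ (n ⊗ Z))) ⊜ ((A ⊕ O) ⊕ ⊝ ((Κ 1ℚ ⊕ n) ⊗ Z)))
           refl (coeff (actC γᵏ z) e) (coeff z e) (coeff (orbitSum γ z k) e) (ℤtoℚ (ℤ.+ k)) ⟩
    (coeff (actC γᵏ z) e ℚ.+ coeff (orbitSum γ z k) e) ℚ.- (1ℚ ℚ.+ ℤtoℚ (ℤ.+ k)) ℚ.* coeff z e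
      ≡⟨ cong₂ (λ s t → s ℚ.- t ℚ.* coeff z e) (coeff-++ (actC γᵏ z) (orbitSum γ z k) e)
           (ℤtoℚ-homo-+ (ℤ.+ 1) (ℤ.+ k)) ⟨
    coeff (orbitSum γ z (suc k)) e ℚ.- ℤtoℚ (ℤ.+ suc k) ℚ.* coeff z e ∎
    where
    open ≡-Reasoning
    γᵏ = Zops.pow γ k

pow-closed : ∀ {Γ} → FiniteIndexSubgroup Γ → ∀ {g} → Γ g → ∀ k → Γ (Zops.pow g k)
pow-closed Γ-fi g∈Γ zero = FiniteIndexSubgroup.one Γ-fi
pow-closed Γ-fi {g} g∈Γ (suc k) =
  FiniteIndexSubgroup.mul Γ-fi g (Zops.pow g k) g∈Γ (pow-closed Γ-fi g∈Γ k)

CoinvEq-respˡ : ∀ {Γ c c′ d} → c ≋ c′ → CoinvEq Γ c′ d → CoinvEq Γ c d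
CoinvEq-respˡ {c = c} {c′} {d} c≋c′ (ws , ws-valid , c′-d≈ws) = ws , ws-valid , λ e e-wf →
  trans (coeff-++ c (negC d) e) (trans (cong (ℚ._+ coeff (negC d) e) (coeff-eq c≋c′ e))
    (trans (sym (coeff-++ c′ (negC d) e)) (c′-d≈ws e e-wf)))

hex-telescope : ∀ γ f c → (∀ k → InSL3 (Zops.pow γ k)) → Nonzero (vℤtoℚ f) → Nonzero (vℤtoℚ c) →
  (∀ k → det3v (vℤtoℚ f) (vℤtoℚ (Zops.pow γ k Zops.*v f)) (vℤtoℚ (Zops.pow γ (suc k) Zops.*v f)) ≡ 0ℚ) →
  (∀ k → vℤtoℚ (Zops.pow γ k Zops.*v c) ∥ vℤtoℚ c) →
  ∀ m → hexℤ f (Zops.pow γ m Zops.*v f) c ≋ orbitSum γ (hexℤ f (γ Zops.*v f) c) m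
hex-telescope γ f c γᵏ∈SL f≢0 c≢0 coplanar on-line zero = ≋-reflexive (begin
  hexℤ f (Zops.pow γ 0 Zops.*v f) c
    ≡⟨ cong (λ t → hexℤ f t c) (idM-*v f) ⟩
  hexℤ f f c
    ≡⟨ hex-dependent (vℤtoℚ f) (vℤtoℚ f) (vℤtoℚ c) (det3v-repeat (vℤtoℚ f) (vℤtoℚ c)) ⟩
  [] ∎)
  where open ≡-Reasoning
hex-telescope γ f c γᵏ∈SL f≢0 c≢0 coplanar on-line (suc k) =
  ≋-trans (hex-split (vℤtoℚ f) (vℤtoℚ γᵏf) (vℤtoℚ γᵏ⁺¹f) (vℤtoℚ c) (vℤtoℚ (γᵏ Zops.*v c))
            f≢0 (nonzero k f f≢0) (nonzero (suc k) f f≢0) c≢0 (nonzero k c c≢0) (coplanar k) (on-line k))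
    (≋-trans (++-cong (hex-telescope γ f c γᵏ∈SL f≢0 c≢0 coplanar on-line k) (≋-reflexive (sym translate)))
      (++-comm-≋ (orbitSum γ σ k) (actC γᵏ σ)))
  where
  open ≡-Reasoning
  γᵏ = Zops.pow γ k
  γᵏf = γᵏ Zops.*v f
  γᵏ⁺¹f = Zops.pow γ (suc k) Zops.*v f
  σ = hexℤ f (γ Zops.*v f) c

  nonzero : ∀ j x → Nonzero (vℤtoℚ x) → Nonzero (vℤtoℚ (Zops.pow γ j Zops.*v x))
  nonzero j x = SL-nonzero (Zops.pow γ j) x (γᵏ∈SL j)

  translate : actC γᵏ σ ≡ hexℤ γᵏf γᵏ⁺¹f (γᵏ Zops.*v c)
  translate = begin
    actC γᵏ σ
      ≡⟨ actC-hexℤ γᵏ f (γ Zops.*v f) c (γᵏ∈SL k) ⟩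
    hexℤ γᵏf (γᵏ Zops.*v (γ Zops.*v f)) (γᵏ Zops.*v c)
      ≡⟨ cong (λ t → hexℤ γᵏf t (γᵏ Zops.*v c)) (trans (pow-*v-comm γ k f) (sym (pow-suc-*v γ k f))) ⟩
    hexℤ γᵏf γᵏ⁺¹f (γᵏ Zops.*v c) ∎

-- The conjugate of M(h,u)

InPlane : M3 ℤ → V3 ℤ → Set
InPlane d x = Σ (V3 ℤ) λ w → (z w ≡ ℤ.+ 0) × (d Zops.*v w ≡ x)

InPlane-coplanar : ∀ d a b c → InPlane d a → InPlane d b → InPlane d c →
  det3v (vℤtoℚ a) (vℤtoℚ b) (vℤtoℚ c) ≡ 0ℚ
InPlane-coplanar d _ _ _ (wa , wa₃≡0 , refl) (wb , wb₃≡0 , refl) (wc , wc₃≡0 , refl) = begin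
  det3v (vℤtoℚ (d Zops.*v wa)) (vℤtoℚ (d Zops.*v wb)) (vℤtoℚ (d Zops.*v wc))
    ≡⟨ cong₂ (λ p (qr : V3 ℚ × V3 ℚ) → det3v p (proj₁ qr) (proj₂ qr)) (vℤtoℚ-homo-*v d wa)
         (cong₂ _,_ (vℤtoℚ-homo-*v d wb) (vℤtoℚ-homo-*v d wc)) ⟩
  det3v (m *v vℤtoℚ wa) (m *v vℤtoℚ wb) (m *v vℤtoℚ wc)
    ≡⟨ det3v-*v m (vℤtoℚ wa) (vℤtoℚ wb) (vℤtoℚ wc) ⟩
  det3 m ℚ.* det3v (vℤtoℚ wa) (vℤtoℚ wb) (vℤtoℚ wc)
    ≡⟨ cong (det3 m ℚ.*_) (det3v-horizontal (vℤtoℚ wa) (vℤtoℚ wb) (vℤtoℚ wc)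
         (cong ℤtoℚ wa₃≡0) (cong ℤtoℚ wb₃≡0) (cong ℤtoℚ wc₃≡0)) ⟩
  det3 m ℚ.* 0ℚ
    ≡⟨ ℚP.*-zeroʳ (det3 m) ⟩
  0ℚ ∎
  where
  open ≡-Reasoning
  m = mℤtoℚ d

Mhu-horizontal : ∀ h u w → z w ≡ ℤ.+ 0 → z (Mhu h u Zops.*v w) ≡ ℤ.+ 0
Mhu-horizontal h u (v3 w₁ w₂ _) refl = trans (ℤP.+-identityˡ _) (ℤP.*-zeroʳ (det2 h))

InPlane-Mhu-conjugate : ∀ h u d → InSL3 d → ∀ x → InPlane d x →
  InPlane d (((d Zops.*M Mhu h u) Zops.*M Zops.adj d) Zops.*v x)
InPlane-Mhu-conjugate h u d d∈SL _ (w , w₃≡0 , refl) =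
  Mhu h u Zops.*v w , Mhu-horizontal h u w w₃≡0 , sym (conjugate-intertwines d (Mhu h u) w d∈SL)

EigenLine : M3 ℤ → V3 ℤ → Set
EigenLine g a = Σ ℚ λ r → vℤtoℚ (g Zops.*v a) ≡ r ·v vℤtoℚ a

EigenLine⇒∥ : ∀ g a → EigenLine g a → vℤtoℚ (g Zops.*v a) ∥ vℤtoℚ a
EigenLine⇒∥ g a (r , ga≡ra) = begin
  cross (vℤtoℚ (g Zops.*v a)) (vℤtoℚ a)  ≡⟨ cong (λ t → cross t (vℤtoℚ a)) ga≡ra ⟩
  cross (r ·v vℤtoℚ a) (vℤtoℚ a)         ≡⟨ cross-scaleˡ r (vℤtoℚ a) (vℤtoℚ a) ⟩
  r ·v cross (vℤtoℚ a) (vℤtoℚ a)         ≡⟨ cong (r ·v_) (cross-self (vℤtoℚ a)) ⟩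
  r ·v zero3                             ≡⟨ scale-zeroʳ r ⟩
  zero3                                  ∎
  where open ≡-Reasoning

EigenLine-intertwine : ∀ g g′ d a → (∀ w → g Zops.*v (d Zops.*v w) ≡ d Zops.*v (g′ Zops.*v w)) →
  EigenLine g′ a → EigenLine g (d Zops.*v a)
EigenLine-intertwine g g′ d a g∘d≡d∘g′ (r , g′a≡ra) = r , (begin
  vℤtoℚ (g Zops.*v (d Zops.*v a))   ≡⟨ cong vℤtoℚ (g∘d≡d∘g′ a) ⟩
  vℤtoℚ (d Zops.*v (g′ Zops.*v a))  ≡⟨ vℤtoℚ-homo-*v d (g′ Zops.*v a) ⟩
  mℤtoℚ d *v vℤtoℚ (g′ Zops.*v a)   ≡⟨ cong (mℤtoℚ d *v_) g′a≡ra ⟩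
  mℤtoℚ d *v (r ·v vℤtoℚ a)         ≡⟨ *v-scale (mℤtoℚ d) r (vℤtoℚ a) ⟩
  r ·v (mℤtoℚ d *v vℤtoℚ a)         ≡⟨ cong (r ·v_) (vℤtoℚ-homo-*v d a) ⟨
  r ·v vℤtoℚ (d Zops.*v a)          ∎)
  where open ≡-Reasoning

EigenLine-pow : ∀ g a → EigenLine g a → ∀ k → EigenLine (Zops.pow g k) a
EigenLine-pow g a _ zero = 1ℚ , trans (cong vℤtoℚ (idM-*v a)) (sym (scale-one (vℤtoℚ a)))
EigenLine-pow g a (r , ga≡ra) (suc k) = rₖ ℚ.* r , (begin
  vℤtoℚ (Zops.pow g (suc k) Zops.*v a)        ≡⟨ cong vℤtoℚ (pow-suc-*v g k a) ⟩
  vℤtoℚ (g Zops.*v (Zops.pow g k Zops.*v a))  ≡⟨ vℤtoℚ-homo-*v g (Zops.pow g k Zops.*v a) ⟩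
  mℤtoℚ g *v vℤtoℚ (Zops.pow g k Zops.*v a)   ≡⟨ cong (mℤtoℚ g *v_) gᵏa≡rₖa ⟩
  mℤtoℚ g *v (rₖ ·v vℤtoℚ a)                  ≡⟨ *v-scale (mℤtoℚ g) rₖ (vℤtoℚ a) ⟩
  rₖ ·v (mℤtoℚ g *v vℤtoℚ a)                  ≡⟨ cong (rₖ ·v_) (vℤtoℚ-homo-*v g a) ⟨
  rₖ ·v vℤtoℚ (g Zops.*v a)                   ≡⟨ cong (rₖ ·v_) ga≡ra ⟩
  rₖ ·v (r ·v vℤtoℚ a)                        ≡⟨ scale-assoc rₖ r (vℤtoℚ a) ⟩
  (rₖ ℚ.* r) ·v vℤtoℚ a                       ∎)
  where
  open ≡-Reasoning
  rₖ = proj₁ (EigenLine-pow g a (r , ga≡ra) k)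
  gᵏa≡rₖa = proj₂ (EigenLine-pow g a (r , ga≡ra) k)

module _ (D : ℕ) where
  open Eops D

  re-*E-ℤtoE : ∀ μ p → re (μ *E ℤtoE p) ≡ re μ ℚ.* ℤtoℚ p
  re-*E-ℤtoE μ p = begin
    re μ ℚ.* ℤtoℚ p ℚ.+ Dℚ ℚ.* (im μ ℚ.* 0ℚ)   ≡⟨ cong (λ t → re μ ℚ.* ℤtoℚ p ℚ.+ Dℚ ℚ.* t)
                                                      (ℚP.*-zeroʳ (im μ)) ⟩
    re μ ℚ.* ℤtoℚ p ℚ.+ Dℚ ℚ.* 0ℚ             ≡⟨ cong (re μ ℚ.* ℤtoℚ p ℚ.+_) (ℚP.*-zeroʳ Dℚ) ⟩
    re μ ℚ.* ℤtoℚ p ℚ.+ 0ℚ                    ≡⟨ ℚP.+-identityʳ _ ⟩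
    re μ ℚ.* ℤtoℚ p                           ∎
    where open ≡-Reasoning

  re-dot-vℤtoE : ∀ r a → re (Ev.dot (vℤtoE r) (vℤtoE a)) ≡ ℤtoℚ (Zops.dot r a)
  re-dot-vℤtoE r a = trans
    (cong₂ ℚ._+_ (cong₂ ℚ._+_ (re-*E-ℤtoE (ℤtoE (x r)) (x a)) (re-*E-ℤtoE (ℤtoE (y r)) (y a)))
                 (re-*E-ℤtoE (ℤtoE (z r)) (z a)))
    (sym (ℤtoℚ-homo-dot r a))

  Eigen⇒EigenLine : ∀ g a → Eigen g (vℤtoE a) → EigenLine g a
  Eigen⇒EigenLine g a (μ , ga≡μa) = re μ , v3-cong
    (real-part (x g) (x a) (cong (λ v → re (x v)) ga≡μa))
    (real-part (y g) (y a) (cong (λ v → re (y v)) ga≡μa))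
    (real-part (z g) (z a) (cong (λ v → re (z v)) ga≡μa))
    where
    real-part : ∀ row p → re (Ev.dot (vℤtoE row) (vℤtoE a)) ≡ re (μ *E ℤtoE p) →
      ℤtoℚ (Zops.dot row a) ≡ re μ ℚ.* ℤtoℚ p
    real-part row p eq = trans (sym (re-dot-vℤtoE row a)) (trans eq (re-*E-ℤtoE μ p))

  Basis3⇒nonzero : ∀ u v a → Basis3 u v (vℤtoE a) → Nonzero (vℤtoℚ a)
  Basis3⇒nonzero u v a independent a≡0 =
    ℚP.1≢0 (cong re (proj₂ (proj₂ (independent 0E 0E 1E combination≡0))))
    where
    zero-*E : ∀ t → 0E *E t ≡ 0E
    zero-*E ⟨ p , q ⟩ = cong₂ ⟨_,_⟩
      (cong₂ ℚ._+_ (ℚP.*-zeroˡ p) (trans (cong (Dℚ ℚ.*_) (ℚP.*-zeroˡ q)) (ℚP.*-zeroʳ Dℚ)))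
      (cong₂ ℚ._+_ (ℚP.*-zeroˡ q) (ℚP.*-zeroˡ p))

    entry : ∀ s t → 0E *E s +E (0E *E t +E 1E *E 0E) ≡ 0E
    entry s t = cong₂ _+E_ (zero-*E s)
      (cong₂ _+E_ (zero-*E t) (cong (λ q → ⟨ 0ℚ ℚ.+ q , 0ℚ ⟩) (ℚP.*-zeroʳ Dℚ)))

    vℤtoE-a≡0 : vℤtoE a ≡ Ev.zero3
    vℤtoE-a≡0 = v3-cong (cong (λ q → ⟨ q , 0ℚ ⟩) (cong x a≡0))
      (cong (λ q → ⟨ q , 0ℚ ⟩) (cong y a≡0)) (cong (λ q → ⟨ q , 0ℚ ⟩) (cong z a≡0))

    combination≡0 : (0E Ev.·v u) Ev.+v ((0E Ev.·v v) Ev.+v (1E Ev.·v vℤtoE a)) ≡ Ev.zero3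
    combination≡0 = trans (cong (λ w → (0E Ev.·v u) Ev.+v ((0E Ev.·v v) Ev.+v (1E Ev.·v w))) vℤtoE-a≡0)
      (v3-cong (entry (x u) (x v)) (entry (y u) (y v)) (entry (z u) (z v)))

lemma5p8 : (Γ : M3 ℤ → Set) → FiniteIndexSubgroup Γ →
    (D : ℕ) → SquarefreeGe2 D →
    (h : M2 ℤ) → InGL2 h → Eops.Unital D h →
    (u : V2 ℤ) →
    (b : V3 E) (a : V3 ℤ) →
    Eops.Eigen D (Mhu h u) b →
    Eops.Eigen D (Mhu h u) (Eops.conjV D b) →
    Eops.Eigen D (Mhu h u) (Eops.vℤtoE D a) →
    Eops.Basis3 D b (Eops.conjV D b) (Eops.vℤtoE D a) →
    (d : M3 ℤ) → InSL3 d →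
    (n : ℕ) → LeastPowerIn Γ ((d Zops.*M Mhu h u) Zops.*M Zops.adj d) n →
    let γ = Zops.pow ((d Zops.*M Mhu h u) Zops.*M Zops.adj d) n
        f = d Zops.*v e₁
        da = d Zops.*v a
    in (m : ℕ) → 1 ℕ.≤ m →
       CoinvEq Γ (hexℤ f (Zops.pow γ m Zops.*v f) da)
                 (scaleC (ℤ.+ m ℚ./ 1) (hexℤ f (γ Zops.*v f) da))
lemma5p8 Γ Γ-fi D _ h _ _ u b a _ _ a-eigen basis d d∈SL n (_ , γ∈Γ , _) m _ =
  CoinvEq-respˡ (hex-telescope γ f da γᵏ∈SL f≢0 da≢0 coplanar on-line m)
    (coinvariant-orbitSum Γ γ (hexℤ f (γ Zops.*v f) da) (pow-closed Γ-fi γ∈Γ) (hex-InSt _ _ _) m)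
  where
  M = Mhu h u
  C = (d Zops.*M M) Zops.*M Zops.adj d
  γ = Zops.pow C n
  f = d Zops.*v e₁
  da = d Zops.*v a
  C∘d≡d∘M = λ w → conjugate-intertwines d M w d∈SL
  γᵏ∈SL = λ k → FiniteIndexSubgroup.sub Γ-fi (Zops.pow γ k) (pow-closed Γ-fi γ∈Γ k)
  f≢0 = SL-nonzero d e₁ d∈SL (λ ())
  da≢0 = SL-nonzero d a d∈SL (Basis3⇒nonzero D b (Eops.conjV D b) a basis)
  γᵏ-plane = pow-preserves (InPlane d) γ
    (pow-preserves (InPlane d) C (InPlane-Mhu-conjugate h u d d∈SL) n)
  f∈plane : InPlane d f
  f∈plane = e₁ , refl , refl
  coplanar = λ k → InPlane-coplanar d f _ _ f∈plane (γᵏ-plane k f f∈plane) (γᵏ-plane (suc k) f f∈plane)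
  on-line = λ k → EigenLine⇒∥ (Zops.pow γ k) da (EigenLine-pow γ da
    (EigenLine-pow C da (EigenLine-intertwine C M d a C∘d≡d∘M (Eigen⇒EigenLine D M a a-eigen)) n) k)
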